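{- In the construction described in the context, for every $1\leq i\leq s$, $\mathcal{E}(H_i)-\mathcal{E}(H_{i-1})\geq w_i^2/p^2$.
   Context: Fix a prime $p$. Write $x^Ty=\sum_kx_ky_k$ and $\langle S\rangle^\perp=\{x:x^Ty=0\ \forall y\in S\}$. Let $e_1,\dots,e_n$ be the standard basis. Define $d_1=1$, $d_2=2$, $d_{j+1}=p^{D_j-3}$ ($j\geq2$), $D_0=0$, $D_i=d_1+\dots+d_i$. Fix $s\in\mathbb{N}$ and assume $n\geq D_s$. For $0\leq i\leq s$ let $H_i=\langle e_1,\dots,e_{D_i}\rangle^\perp$ and $U_i=\mathbb{F}_p^{D_i}\times\{0\}^{n-D_i}$. For each $1\leq i\leq s$ fix a tuple $X_i=(\xi^{(i)}_u:u\in U_{i-1})$ of non-zero vectors of $H_{i-1}$ such that every subfamily of at least $\frac34|X_i|$ entries spans $\langle e_{D_{i-1}+1},\dots,e_{D_i}\rangle$. Let $A_i=\bigcup_{u\in U_{i-1}}\big((H_{i-1}\cap\langle\xi^{(i)}_u\rangle^\perp)+u\big)$. Fix weights $w_1,\dots,w_s\in(0,1)$ with $\sum w_i\leq1$, and set $f=\sum_{i=1}^sw_i1_{A_i}$. For a subspace $H$, the energy is $\mathcal{E}(H)=\mathbb{E}_{x\in\mathbb{F}_p^n}\big(\mathbb{E}_{y\in H+x}f(y)\big)^2$.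
   Formalization: The weights $w_1,\dots,w_s$ are rational numbers in (0,1). -}

module Defs where

open import Data.Nat as ℕ using (ℕ; zero; suc; _∸_; _^_; _%_; _≡ᵇ_)
import Data.Nat.Properties as ℕP
open import Data.Bool using (Bool; true; false; if_then_else_; _∧_)
open import Data.Fin using (Fin; toℕ)
open import Data.List as List using (List; []; _∷_; upTo; concatMap; length; filter)
open import Data.Bool.ListAction using (any; all)
open import Data.Nat.ListAction using (sum)
open import Data.List.Membership.Propositional using (_∈_)
open import Data.List.Relation.Unary.All using (All)
open import Data.List.Relation.Unary.Unique.Propositional using (Unique)
open import Data.Vec as Vec using (Vec; []; _∷_; zipWith; tabulate; replicate; toList)
open import Data.Integer using (+_)
open import Data.Rational as ℚ using (ℚ; 0ℚ; 1ℚ; _/_)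
open import Data.Product using (Σ; _×_)
open import Relation.Binary.PropositionalEquality using (_≡_)
open import Relation.Nullary using (¬_)
open import Function.Bundles using (_⇔_)

-- The dimension sequence (depends on p).
-- d 1 = 1, d 2 = 2, d (j+1) = p ^ (D j - 3) for j ≥ 2;  D 0 = 0, D i = d 1 + ... + d i.
-- (d 0 is unused and set to 0.)

mutual
  d : ℕ → ℕ → ℕ
  d p zero = 0
  d p (suc zero) = 1
  d p (suc (suc zero)) = 2
  d p (suc (suc (suc j))) = p ^ (D p (suc (suc j)) ∸ 3)

  D : ℕ → ℕ → ℕ
  D p zero = 0
  D p (suc i) = D p i ℕ.+ d p (suc i)

-- Arithmetic in 𝔽_p, elements represented by their residues 0 … p-1 (as ℕ).
-- (p is a prime in the statement, so the p = 0 clauses are never used.)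

modp : ℕ → ℕ → ℕ
modp zero a = a
modp (suc q) a = a % suc q

-- Vectors of 𝔽_p^n : Vec ℕ n with all entries reduced.
-- The list of all vectors of 𝔽_p^n (each exactly once).
allVecs : (p n : ℕ) → List (Vec ℕ n)
allVecs p zero = [] ∷ []
allVecs p (suc n) = concatMap (λ a → List.map (a ∷_) (allVecs p n)) (upTo p)

vadd : (p : ℕ) {n : ℕ} → Vec ℕ n → Vec ℕ n → Vec ℕ n
vadd p = zipWith (λ a b → modp p (a ℕ.+ b))

vsub : (p : ℕ) {n : ℕ} → Vec ℕ n → Vec ℕ n → Vec ℕ n
vsub p = zipWith (λ a b → modp p (a ℕ.+ (p ∸ modp p b)))

vscale : (p : ℕ) {n : ℕ} → ℕ → Vec ℕ n → Vec ℕ n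
vscale p c = Vec.map (λ a → modp p (c ℕ.* a))

zeroV : (n : ℕ) → Vec ℕ n
zeroV n = replicate n 0

dot : (p : ℕ) {n : ℕ} → Vec ℕ n → Vec ℕ n → ℕ
dot p x y = modp p (sum (toList (zipWith ℕ._*_ x y)))

-- e k (0-based position k), i.e. the paper's e_{k+1}
e : (n k : ℕ) → Vec ℕ n
e n k = tabulate (λ j → if toℕ j ≡ᵇ k then 1 else 0)

lincomb : (p : ℕ) {n : ℕ} → List ℕ → List (Vec ℕ n) → Vec ℕ n
lincomb p {n} (c ∷ cs) (v ∷ vs) = vadd p (vscale p c v) (lincomb p cs vs)
lincomb p {n} _ _ = zeroV n

InSpan : (p : ℕ) {n : ℕ} → List (Vec ℕ n) → Vec ℕ n → Set
InSpan p L v = Σ (List ℕ) λ c → (length c ≡ length L) × (lincomb p c L ≡ v)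

SameSpan : (p n : ℕ) → List (Vec ℕ n) → List (Vec ℕ n) → Set
SameSpan p n L M = ∀ v → v ∈ allVecs p n → (InSpan p L v ⇔ InSpan p M v)

-- e_{a+1}, …, e_b
basisRange : (n a b : ℕ) → List (Vec ℕ n)
basisRange n a b = List.map (λ t → e n (a ℕ.+ t)) (upTo (b ∸ a))

-- H_i = ⟨e_1,…,e_{D_i}⟩^⊥  (as a decidable membership test)

inH : (p n i : ℕ) → Vec ℕ n → Bool
inH p n i x = all (λ k → dot p x (e n k) ≡ᵇ 0) (upTo (D p i))

-- pad a vector of length m with zeros to length n (m ≤ n in all uses)
padTo : (n : ℕ) {m : ℕ} → Vec ℕ m → Vec ℕ n
padTo zero v = []
padTo (suc n) [] = 0 ∷ padTo n []
padTo (suc n) (x ∷ xs) = x ∷ padTo n xs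

-- U_i = 𝔽_p^{D_i} × {0}^{n - D_i}, listed
allU : (p n i : ℕ) → List (Vec ℕ n)
allU p n i = List.map (padTo n) (allVecs p (D p i))

-- A_i = ⋃_{u ∈ U_{i-1}} ((H_{i-1} ∩ ⟨ξ_u⟩^⊥) + u), where ξ = ξ^{(i)}
inA : (p n i : ℕ) → (Vec ℕ n → Vec ℕ n) → Vec ℕ n → Bool
inA p n i ξ y =
  any (λ u → inH p n (i ∸ 1) (vsub p y u) ∧ (dot p (vsub p y u) (ξ u) ≡ᵇ 0))
      (allU p n (i ∸ 1))

indicator : Bool → ℚ
indicator true = 1ℚ
indicator false = 0ℚ

sumℚ : List ℚ → ℚ
sumℚ = List.foldr ℚ._+_ 0ℚ

-- 1 / m  (m > 0 in all uses)
recipℕ : ℕ → ℚ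
recipℕ zero = 0ℚ
recipℕ (suc m) = + 1 / suc m

ℕtoℚ : ℕ → ℚ
ℕtoℚ m = + m / 1

mean : List ℚ → ℚ
mean [] = 0ℚ
mean (x ∷ xs) = sumℚ (x ∷ xs) ℚ.* recipℕ (suc (length xs))

sumFrom1 : ℕ → (ℕ → ℚ) → ℚ
sumFrom1 zero g = 0ℚ
sumFrom1 (suc s) g = sumFrom1 s g ℚ.+ g (suc s)

f : (p n s : ℕ) → (ℕ → Vec ℕ n → Vec ℕ n) → (ℕ → ℚ) → Vec ℕ n → ℚ
f p n s ξ w y = sumFrom1 s (λ i → w i ℚ.* indicator (inA p n i (ξ i) y))

-- 𝓔(H) = 𝔼_{x ∈ 𝔽_p^n} (𝔼_{y ∈ H + x} f(y))^2, for a subspace H given by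
-- a membership test; y ∈ H + x  iff  y - x ∈ H.
energy : (p n : ℕ) → (Vec ℕ n → Bool) → (Vec ℕ n → ℚ) → ℚ
energy p n H F =
  mean (List.map (λ x → let a = mean (List.map F (filter (λ y → H (vsub p y x) Data.Bool.≟ true) (allVecs p n)))
                        in a ℚ.* a)
                 (allVecs p n))

-- Hypotheses on the tuples X_i = (ξ^{(i)}_u : u ∈ U_{i-1}), 1 ≤ i ≤ s.
-- ξ i u is ξ^{(i)}_u (values for u ∉ U_{i-1} or i ∉ [1,s] are irrelevant).

ValidX : (p n s : ℕ) → (ℕ → Vec ℕ n → Vec ℕ n) → Set
ValidX p n s ξ = ∀ i → 1 ℕ.≤ i → i ℕ.≤ s → ∀ u → u ∈ allU p n (i ∸ 1) →
  (ξ i u ∈ allVecs p n) × (¬ ξ i u ≡ zeroV n) × (inH p n (i ∸ 1) (ξ i u) ≡ true)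

-- every subfamily of at least ¾|X_i| entries spans ⟨e_{D_{i-1}+1},…,e_{D_i}⟩
-- (a subfamily is given by a duplicate-free list S of indices in U_{i-1};
--  |X_i| = |U_{i-1}| = p^{D_{i-1}})
SpanningX : (p n s : ℕ) → (ℕ → Vec ℕ n → Vec ℕ n) → Set
SpanningX p n s ξ = ∀ i → 1 ℕ.≤ i → i ℕ.≤ s →
  ∀ (S : List (Vec ℕ n)) → Unique S → All (_∈ allU p n (i ∸ 1)) S →
  3 ℕ.* p ^ D p (i ∸ 1) ℕ.≤ 4 ℕ.* length S →
  SameSpan p n (List.map (ξ i) S) (basisRange n (D p (i ∸ 1)) (D p i))

-- Let E_k(x) be the average of f over the coset x + H_k. The spanning hypothesis, applied to the whole
-- family X_j, puts every ξ^{(j)}_u in ⟨e_{D_{j-1}+1},…,e_{D_j}⟩, so A_j is a union of cosets of H_j;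
-- and since ξ^{(j)}_u is a non-zero vector of H_{j-1}, A_j meets every coset of H_{j-1} in exactly a
-- 1/p proportion (a non-zero linear form is equidistributed over 𝔽_p). Hence
-- E_k = Σ_j w_j (1_{A_j} if j ≤ k, 1/p otherwise), so E_i = B + w_i 1_{A_i} and E_{i-1} = B + w_i/p
-- with B constant on cosets of H_{i-1}. The cross term 2 w_i B (1_{A_i} − 1/p) averages to zero on
-- each such coset, leaving 𝓔(H_i) − 𝓔(H_{i-1}) = w_i² (1/p − 1/p²) ≥ w_i²/p².

module Submission where

open import Defs

open import Data.Bool as Bool using (Bool; true; false; T; if_then_else_; _∧_)
open import Data.Bool.ListAction using (any; all)
open import Data.Bool.Properties using (T-≡; T-∧; not-¬)
open import Data.Empty using (⊥-elim)
import Data.Integer as ℤ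
import Data.Integer.Properties as ℤ
open import Data.List as List using (List; []; _∷_; _++_; concatMap; filter; length; upTo)
import Data.List.Properties as List
open import Data.List.Membership.Propositional using (_∈_; find; lose)
import Data.List.Membership.Propositional.Properties as ∈
open import Data.List.Relation.Unary.All as All using (All; []; _∷_)
import Data.List.Relation.Unary.All.Properties as All
import Data.List.Relation.Unary.AllPairs as AllPairs
open import Data.List.Relation.Unary.AllPairs using (_∷_)
open import Data.List.Relation.Unary.Any using (here; there)
open import Data.List.Relation.Unary.Any.Properties using (any⁺; any⁻)
open import Data.List.Relation.Unary.Unique.Propositional using (Unique)
import Data.List.Relation.Unary.Unique.Propositional.Properties as Unique
open import Data.Nat as ℕ using (ℕ; zero; suc; _≡ᵇ_; _≤ᵇ_; _∸_; _^_; _<_; _≤_; z≤n; s≤s)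
import Data.Nat.Properties as ℕ
open import Data.Nat.Coprimality as Coprime using (Coprime; prime⇒coprime; coprime-Bézout; coprime-divisor)
open import Data.Nat.DivMod
  using (_%_; _/_; m≡m%n+[m/n]*n; %-distribˡ-+; %-distribˡ-*; [m+kn]%n≡m%n; m*n%n≡0; m%n<n; m%n≤n;
         m<n⇒m%n≡m; m%n%n≡m%n; [m+n]%n≡m%n; n%n≡0)
open import Data.Nat.Divisibility using (_∣_; divides; n∣m⇒m%n≡0)
open import Data.Nat.GCD using (module Bézout)
open import Data.Nat.ListAction using (sum)
open import Data.Nat.Primality using (Prime; prime⇒nonTrivial; prime⇒nonZero)
import Data.Nat.Solver
open import Data.Product using (∃; _×_; _,_; proj₁; proj₂)
open import Data.Rational as ℚ using (ℚ; 0ℚ; 1ℚ; _+_; _*_; _-_; toℚᵘ) renaming (_≤_ to _≤ℚ_)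
import Data.Rational.Properties as ℚ
import Data.Rational.Solver
import Data.Rational.Unnormalised as ℚᵘ
import Data.Rational.Unnormalised.Properties as ℚᵘ
open import Data.Sum using (inj₁; inj₂)
open import Data.Vec as Vec using (Vec; []; _∷_; zipWith; toList; tabulate)
import Data.Vec.Properties as Vec
import Data.Vec.Relation.Unary.All as VAll
open import Function using (_∘_; id)
open import Function.Bundles using (Equivalence)
open import Relation.Binary.Definitions using (tri<; tri≈; tri>)
open import Relation.Binary.PropositionalEquality
open import Relation.Nullary using (¬_; Dec; yes; no)

module ℕ-Solver = Data.Nat.Solver.+-*-Solver
module ℚ-Solver = Data.Rational.Solver.+-*-Solver

private variable
  A B : Set

T-ext : {b c : Bool} → (T b → T c) → (T c → T b) → b ≡ c
T-ext {false} {false} _ _ = refl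
T-ext {false} {true}  _ g = ⊥-elim (g _)
T-ext {true}  {false} f _ = ⊥-elim (f _)
T-ext {true}  {true}  _ _ = refl

≡ᵇ-refl : ∀ m → (m ≡ᵇ m) ≡ true
≡ᵇ-refl m = T-ext _ (λ _ → ℕ.≡⇒≡ᵇ m m refl)

≢⇒≡ᵇ-false : ∀ {m n} → ¬ m ≡ n → (m ≡ᵇ n) ≡ false
≢⇒≡ᵇ-false {m} {n} m≢n = T-ext (m≢n ∘ ℕ.≡ᵇ⇒≡ m n) λ ()

≤⇒≤ᵇ-true : ∀ {m n} → m ≤ n → (m ≤ᵇ n) ≡ true
≤⇒≤ᵇ-true m≤n = Equivalence.to T-≡ (ℕ.≤⇒≤ᵇ m≤n)

>⇒≤ᵇ-false : ∀ {m n} → n < m → (m ≤ᵇ n) ≡ false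
>⇒≤ᵇ-false {m} {n} n<m = T-ext (λ m≤ᵇn → ℕ.<⇒≱ n<m (ℕ.≤ᵇ⇒≤ m n m≤ᵇn)) λ ()

≤ᵇ-pred : ∀ {i j} → 1 ≤ i → ¬ j ≡ i → (j ≤ᵇ i ∸ 1) ≡ (j ≤ᵇ i)
≤ᵇ-pred {suc i} {j} _ j≢1+i = T-ext (λ j≤ᵇi → ℕ.≤⇒≤ᵇ (ℕ.m≤n⇒m≤1+n (ℕ.≤ᵇ⇒≤ j i j≤ᵇi)))
  (λ j≤ᵇ1+i → ℕ.≤⇒≤ᵇ (ℕ.≤-pred (ℕ.≤∧≢⇒< (ℕ.≤ᵇ⇒≤ j (suc i) j≤ᵇ1+i) j≢1+i)))

all-map : (g : A → B) (P : B → Bool) (xs : List A) → all P (List.map g xs) ≡ all (P ∘ g) xs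
all-map g P []       = refl
all-map g P (a ∷ xs) = cong (P (g a) ∧_) (all-map g P xs)

all-ext : (P Q : A → Bool) (xs : List A) → (∀ a → P a ≡ Q a) → all P xs ≡ all Q xs
all-ext P Q []       e = refl
all-ext P Q (a ∷ xs) e = cong₂ _∧_ (e a) (all-ext P Q xs e)

all-true : (xs : List A) → all (λ _ → true) xs ≡ true
all-true []       = refl
all-true (a ∷ xs) = all-true xs

all-upTo-suc : ∀ m (P : ℕ → Bool) → all P (upTo (suc m)) ≡ P 0 ∧ all (P ∘ suc) (upTo m)
all-upTo-suc m P = cong (P 0 ∧_) (trans (cong (all P) (sym (List.map-upTo suc m))) (all-map suc P (upTo m)))

any-∧-unique : (xs : List A) (P Q : A → Bool) {a₀ : A} → a₀ ∈ xs → T (P a₀) →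
  (∀ {a} → a ∈ xs → T (P a) → a ≡ a₀) → any (λ a → P a ∧ Q a) xs ≡ Q a₀
any-∧-unique xs P Q {a₀} a₀∈xs Pa₀ unique = T-ext only-a₀ from-a₀
  where
  only-a₀ : T (any (λ a → P a ∧ Q a) xs) → T (Q a₀)
  only-a₀ t with a , a∈xs , PQa ← find (any⁻ _ xs t) with Pa , Qa ← Equivalence.to T-∧ PQa
    rewrite unique a∈xs Pa = Qa
  from-a₀ : T (Q a₀) → T (any (λ a → P a ∧ Q a) xs)
  from-a₀ Qa₀ = any⁺ _ (lose a₀∈xs (Equivalence.from T-∧ (Pa₀ , Qa₀)))

filterᵇ : (A → Bool) → List A → List A
filterᵇ b = filter (λ a → b a Bool.≟ true)

filterᵇ-cong : (b c : A → Bool) (xs : List A) → (∀ a → b a ≡ c a) → filterᵇ b xs ≡ filterᵇ c xs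
filterᵇ-cong b c xs b≗c = List.filter-≐ (λ a → b a Bool.≟ true) (λ a → c a Bool.≟ true)
  ((λ {a} → trans (sym (b≗c a))) , (λ {a} → trans (b≗c a))) xs

filterᵇ-all : (b : A → Bool) (xs : List A) → (∀ a → b a ≡ true) → filterᵇ b xs ≡ xs
filterᵇ-all b xs all-b = List.filter-all (λ a → b a Bool.≟ true) {xs = xs} (All.tabulate λ {a} _ → all-b a)

filterᵇ-none : (b : A → Bool) (xs : List A) → (∀ a → b a ≡ false) → filterᵇ b xs ≡ []
filterᵇ-none b xs no-b = List.filter-none (λ a → b a Bool.≟ true) {xs = xs} (All.tabulate λ {a} _ → not-¬ (no-b a))

filterᵇ-map : (b : B → Bool) (g : A → B) (xs : List A) →
  filterᵇ b (List.map g xs) ≡ List.map g (filterᵇ (b ∘ g) xs)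
filterᵇ-map b g []       = refl
filterᵇ-map b g (a ∷ xs) with b (g a)
... | true  = cong (g a ∷_) (filterᵇ-map b g xs)
... | false = filterᵇ-map b g xs

filterᵇ-concatMap : (b : B → Bool) (g : A → List B) (xs : List A) →
  filterᵇ b (concatMap g xs) ≡ concatMap (filterᵇ b ∘ g) xs
filterᵇ-concatMap b g []       = refl
filterᵇ-concatMap b g (a ∷ xs) =
  trans (List.filter-++ (λ a → b a Bool.≟ true) (g a) (concatMap g xs))
        (cong (filterᵇ b (g a) ++_) (filterᵇ-concatMap b g xs))

concatMap-cong-All : {g g′ : A → List B} {xs : List A} → All (λ a → g a ≡ g′ a) xs → concatMap g xs ≡ concatMap g′ xs
concatMap-cong-All []       = refl
concatMap-cong-All (e ∷ es) = cong₂ _++_ e (concatMap-cong-All es)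

concatMap-if-≡ᵇ : (ys : List A) {k : ℕ} (xs : List ℕ) → Unique xs → k ∈ xs →
  concatMap (λ a → if a ≡ᵇ k then ys else []) xs ≡ ys
concatMap-if-≡ᵇ ys (a ∷ xs) (a∉xs ∷ _) (here refl) rewrite ≡ᵇ-refl a =
  trans (cong (ys ++_) (none xs a∉xs)) (List.++-identityʳ ys)
  where
  none : ∀ xs → All (λ b → ¬ a ≡ b) xs → concatMap (λ b → if b ≡ᵇ a then ys else []) xs ≡ []
  none []       []           = refl
  none (b ∷ xs) (a≢b ∷ a∉xs) rewrite ≢⇒≡ᵇ-false (a≢b ∘ sym) = none xs a∉xs
concatMap-if-≡ᵇ ys (a ∷ xs) (a∉xs ∷ u) (there k∈xs) rewrite ≢⇒≡ᵇ-false (All.lookup a∉xs k∈xs) =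
  concatMap-if-≡ᵇ ys xs u k∈xs

∑ : List A → (A → ℚ) → ℚ
∑ xs h = sumℚ (List.map h xs)

∑-cong : {xs : List A} {h h′ : A → ℚ} → All (λ a → h a ≡ h′ a) xs → ∑ xs h ≡ ∑ xs h′
∑-cong []       = refl
∑-cong (e ∷ es) = cong₂ _+_ e (∑-cong es)

∑-ext : (xs : List A) {h h′ : A → ℚ} → (∀ a → h a ≡ h′ a) → ∑ xs h ≡ ∑ xs h′
∑-ext xs e = ∑-cong {xs = xs} (All.tabulate λ {a} _ → e a)

∑-++ : (xs ys : List A) (h : A → ℚ) → ∑ (xs ++ ys) h ≡ ∑ xs h + ∑ ys h
∑-++ []       ys h = sym (ℚ.+-identityˡ _)
∑-++ (a ∷ xs) ys h = trans (cong (h a +_) (∑-++ xs ys h)) (sym (ℚ.+-assoc (h a) _ _))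

∑-map : (g : A → B) (xs : List A) (h : B → ℚ) → ∑ (List.map g xs) h ≡ ∑ xs (h ∘ g)
∑-map g []       h = refl
∑-map g (a ∷ xs) h = cong (h (g a) +_) (∑-map g xs h)

∑-concatMap : (g : A → List B) (xs : List A) (h : B → ℚ) →
  ∑ (concatMap g xs) h ≡ ∑ xs (λ a → ∑ (g a) h)
∑-concatMap g []       h = refl
∑-concatMap g (a ∷ xs) h =
  trans (∑-++ (g a) (concatMap g xs) h) (cong (∑ (g a) h +_) (∑-concatMap g xs h))

∑-0 : (xs : List A) → ∑ xs (λ _ → 0ℚ) ≡ 0ℚ
∑-0 []       = refl
∑-0 (a ∷ xs) = trans (ℚ.+-identityˡ _) (∑-0 xs)

∑-+ : (xs : List A) (h h′ : A → ℚ) → ∑ xs (λ a → h a + h′ a) ≡ ∑ xs h + ∑ xs h′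
∑-+ []       h h′ = refl
∑-+ (a ∷ xs) h h′ = trans (cong (h a + h′ a +_) (∑-+ xs h h′))
  (solve 4 (λ x y z w → (x :+ y) :+ (z :+ w) := (x :+ z) :+ (y :+ w)) refl
    (h a) (h′ a) (∑ xs h) (∑ xs h′))
  where open ℚ-Solver

∑-- : (xs : List A) (h h′ : A → ℚ) → ∑ xs (λ a → h a - h′ a) ≡ ∑ xs h - ∑ xs h′
∑-- []       h h′ = refl
∑-- (a ∷ xs) h h′ = trans (cong (h a - h′ a +_) (∑-- xs h h′))
  (solve 4 (λ x y z w → (x :- y) :+ (z :- w) := (x :+ z) :- (y :+ w)) refl
    (h a) (h′ a) (∑ xs h) (∑ xs h′))
  where open ℚ-Solver

∑-*ˡ : (xs : List A) (c : ℚ) (h : A → ℚ) → ∑ xs (λ a → c * h a) ≡ c * ∑ xs h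
∑-*ˡ []       c h = sym (ℚ.*-zeroʳ c)
∑-*ˡ (a ∷ xs) c h = trans (cong (c * h a +_) (∑-*ˡ xs c h)) (sym (ℚ.*-distribˡ-+ c (h a) _))

∑-*ʳ : (xs : List A) (h : A → ℚ) (c : ℚ) → ∑ xs (λ a → h a * c) ≡ ∑ xs h * c
∑-*ʳ xs h c = begin
  ∑ xs (λ a → h a * c) ≡⟨ ∑-ext xs (λ a → ℚ.*-comm (h a) c) ⟩
  ∑ xs (λ a → c * h a) ≡⟨ ∑-*ˡ xs c h ⟩
  c * ∑ xs h           ≡⟨ ℚ.*-comm c _ ⟩
  ∑ xs h * c           ∎
  where open ≡-Reasoning

-- ℕ → ℚ by repeated addition, so that both homomorphism laws are inductions on ℕ.
fromℕ : ℕ → ℚ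
fromℕ zero    = 0ℚ
fromℕ (suc k) = 1ℚ + fromℕ k

fromℕ-+ : ∀ a b → fromℕ (a ℕ.+ b) ≡ fromℕ a + fromℕ b
fromℕ-+ zero    b = sym (ℚ.+-identityˡ (fromℕ b))
fromℕ-+ (suc a) b = trans (cong (1ℚ +_) (fromℕ-+ a b)) (sym (ℚ.+-assoc 1ℚ (fromℕ a) (fromℕ b)))

fromℕ-* : ∀ a b → fromℕ (a ℕ.* b) ≡ fromℕ a * fromℕ b
fromℕ-* zero    b = sym (ℚ.*-zeroˡ (fromℕ b))
fromℕ-* (suc a) b = trans (fromℕ-+ b (a ℕ.* b)) (trans (cong (fromℕ b +_) (fromℕ-* a b))
  (solve 2 (λ x y → y :+ x :* y := (con 1ℚ :+ x) :* y) refl (fromℕ a) (fromℕ b)))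
  where open ℚ-Solver

fromℕ-1 : fromℕ 1 ≡ 1ℚ
fromℕ-1 = ℚ.+-identityʳ 1ℚ

∑-const : (xs : List A) (c : ℚ) → ∑ xs (λ _ → c) ≡ c * fromℕ (length xs)
∑-const []       c = sym (ℚ.*-zeroʳ c)
∑-const (a ∷ xs) c = trans (cong (c +_) (∑-const xs c))
  (solve 2 (λ c x → c :+ c :* x := c :* (con 1ℚ :+ x)) refl c (fromℕ (length xs)))
  where open ℚ-Solver

∑-indicator-≡ᵇ : ∀ {k} (xs : List ℕ) → Unique xs → k ∈ xs → ∑ xs (λ a → indicator (a ≡ᵇ k)) ≡ 1ℚ
∑-indicator-≡ᵇ (a ∷ xs) (a∉xs ∷ _) (here refl) rewrite ≡ᵇ-refl a =
  trans (cong (1ℚ +_) (trans (∑-cong (All.map (λ a≢b → cong indicator (≢⇒≡ᵇ-false (a≢b ∘ sym))) a∉xs)) (∑-0 xs)))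
        (ℚ.+-identityʳ 1ℚ)
∑-indicator-≡ᵇ (a ∷ xs) (a∉xs ∷ u) (there k∈xs) rewrite ≢⇒≡ᵇ-false (All.lookup a∉xs k∈xs) =
  trans (ℚ.+-identityˡ _) (∑-indicator-≡ᵇ xs u k∈xs)

mean-map : (xs : List A) (h : A → ℚ) → mean (List.map h xs) ≡ ∑ xs h * recipℕ (length xs)
mean-map []       h = refl
mean-map (a ∷ xs) h = cong (λ k → ∑ (a ∷ xs) h * recipℕ (suc k)) (List.length-map h xs)

toℚᵘ-fromℕ : ∀ k → toℚᵘ (fromℕ k) ℚᵘ.≃ ℚᵘ.mkℚᵘ (ℤ.+ k) 0
toℚᵘ-fromℕ zero    = ℚᵘ.*≡* refl
toℚᵘ-fromℕ (suc k) = ℚᵘ.≃-trans (ℚ.toℚᵘ-homo-+ 1ℚ (fromℕ k))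
  (ℚᵘ.≃-trans (ℚᵘ.+-congʳ (toℚᵘ 1ℚ) (toℚᵘ-fromℕ k)) (ℚᵘ.*≡* (cong (λ z → (ℤ.+ 1 ℤ.+ z) ℤ.* ℤ.+ 1) (ℤ.*-identityʳ (ℤ.+ k)))))

recipℕ-inverse : ∀ m → recipℕ (suc m) * fromℕ (suc m) ≡ 1ℚ
recipℕ-inverse m = ℚ.toℚᵘ-injective (ℚᵘ.≃-trans (ℚ.toℚᵘ-homo-* (recipℕ (suc m)) (fromℕ (suc m)))
  (ℚᵘ.≃-trans (ℚᵘ.*-cong (ℚ.toℚᵘ-fromℚᵘ (ℚᵘ.mkℚᵘ (ℤ.+ 1) m)) (toℚᵘ-fromℕ (suc m)))
    (ℚᵘ.*≡* (ℤ.*-assoc (ℤ.+ 1) (ℤ.+ suc m) (ℤ.+ 1)))))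

recipℕ-unique : ∀ m x → x * fromℕ (suc m) ≡ 1ℚ → x ≡ recipℕ (suc m)
recipℕ-unique m x e = begin
  x                         ≡⟨ sym (ℚ.*-identityʳ x) ⟩
  x * 1ℚ                    ≡⟨ cong (x *_) (sym (recipℕ-inverse m)) ⟩
  x * (r * fromℕ (suc m))   ≡⟨ solve 3 (λ x r N → x :* (r :* N) := r :* (x :* N)) refl x r (fromℕ (suc m)) ⟩
  r * (x * fromℕ (suc m))   ≡⟨ cong (r *_) e ⟩
  r * 1ℚ                    ≡⟨ ℚ.*-identityʳ r ⟩
  r                         ∎
  where
  open ≡-Reasoning
  open ℚ-Solver
  r = recipℕ (suc m)

fromℕ-*-recipℕ : ∀ m → 0 < m → fromℕ m * recipℕ m ≡ 1ℚ
fromℕ-*-recipℕ (suc m) _ = trans (ℚ.*-comm (fromℕ (suc m)) _) (recipℕ-inverse m)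

recipℕ-* : ∀ a b → 0 < a → 0 < b → recipℕ (a ℕ.* b) ≡ recipℕ a * recipℕ b
recipℕ-* (suc a) (suc b) _ _ = sym (recipℕ-unique (b ℕ.+ a ℕ.* suc b) _ (begin
  recipℕ (suc a) * recipℕ (suc b) * fromℕ (suc a ℕ.* suc b)
    ≡⟨ cong (recipℕ (suc a) * recipℕ (suc b) *_) (fromℕ-* (suc a) (suc b)) ⟩
  recipℕ (suc a) * recipℕ (suc b) * (fromℕ (suc a) * fromℕ (suc b))
    ≡⟨ solve 4 (λ x y X Y → x :* y :* (X :* Y) := (x :* X) :* (y :* Y)) refl (recipℕ (suc a)) (recipℕ (suc b)) (fromℕ (suc a)) (fromℕ (suc b)) ⟩
  recipℕ (suc a) * fromℕ (suc a) * (recipℕ (suc b) * fromℕ (suc b))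
    ≡⟨ cong₂ _*_ (recipℕ-inverse a) (recipℕ-inverse b) ⟩
  1ℚ * 1ℚ
    ≡⟨ ℚ.*-identityˡ 1ℚ ⟩
  1ℚ ∎))
  where
  open ≡-Reasoning
  open ℚ-Solver

recipℕ-nonNeg : ∀ m → 0ℚ ≤ℚ recipℕ m
recipℕ-nonNeg zero    = ℚ.≤-refl
recipℕ-nonNeg (suc m) = ℚ.nonNegative⁻¹ _ {{ℚ.normalize-nonNeg 1 (suc m)}}

fromℕ-nonNeg : ∀ k → 0ℚ ≤ℚ fromℕ k
fromℕ-nonNeg zero    = ℚ.≤-refl
fromℕ-nonNeg (suc k) = ℚ.+-mono-≤ (ℚ.nonNegative⁻¹ 1ℚ) (fromℕ-nonNeg k)

*-nonNeg : ∀ {a b} → 0ℚ ≤ℚ a → 0ℚ ≤ℚ b → 0ℚ ≤ℚ a * b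
*-nonNeg {a} {b} 0≤a 0≤b = ℚ.nonNegative⁻¹ (a * b) {{ℚ.nonNeg*nonNeg⇒nonNeg a {{ℚ.nonNegative 0≤a}} b {{ℚ.nonNegative 0≤b}}}}

≤-*-fromℕ-suc : ∀ {x} k → 0ℚ ≤ℚ x → x ≤ℚ x * fromℕ (suc k)
≤-*-fromℕ-suc {x} k 0≤x = subst₂ _≤ℚ_ (ℚ.+-identityʳ x)
  (sym (trans (ℚ.*-distribˡ-+ x 1ℚ (fromℕ k)) (cong (_+ x * fromℕ k) (ℚ.*-identityʳ x))))
  (ℚ.+-monoʳ-≤ x (*-nonNeg 0≤x (fromℕ-nonNeg k)))

indicator-idem : ∀ b → indicator b * indicator b ≡ indicator b
indicator-idem true  = ℚ.*-identityˡ 1ℚ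
indicator-idem false = ℚ.*-zeroˡ 0ℚ

sumFrom1-cong : ∀ s {g g′ : ℕ → ℚ} → (∀ {j} → 1 ≤ j → j ≤ s → g j ≡ g′ j) → sumFrom1 s g ≡ sumFrom1 s g′
sumFrom1-cong zero    e = refl
sumFrom1-cong (suc s) e = cong₂ _+_ (sumFrom1-cong s (λ 1≤j j≤s → e 1≤j (ℕ.m≤n⇒m≤1+n j≤s))) (e (s≤s z≤n) ℕ.≤-refl)

sumFrom1-*ʳ : ∀ s (g : ℕ → ℚ) (c : ℚ) → sumFrom1 s g * c ≡ sumFrom1 s (λ j → g j * c)
sumFrom1-*ʳ zero    g c = ℚ.*-zeroˡ c
sumFrom1-*ʳ (suc s) g c = trans (ℚ.*-distribʳ-+ c (sumFrom1 s g) (g (suc s))) (cong (_+ g (suc s) * c) (sumFrom1-*ʳ s g c))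

∑-sumFrom1 : (xs : List A) (s : ℕ) (g : A → ℕ → ℚ) → ∑ xs (λ a → sumFrom1 s (g a)) ≡ sumFrom1 s (λ j → ∑ xs (λ a → g a j))
∑-sumFrom1 xs zero    g = ∑-0 xs
∑-sumFrom1 xs (suc s) g =
  trans (∑-+ xs (λ a → sumFrom1 s (g a)) (λ a → g a (suc s))) (cong (_+ ∑ xs (λ a → g a (suc s))) (∑-sumFrom1 xs s g))

sumFrom1-extract : ∀ s {i} (g : ℕ → ℚ) → 1 ≤ i → i ≤ s →
  sumFrom1 s g ≡ sumFrom1 s (λ j → if j ≡ᵇ i then 0ℚ else g j) + g i
sumFrom1-extract zero    {suc i} g 1≤i ()
sumFrom1-extract (suc s) {i} g 1≤i i≤1+s with ℕ.m≤n⇒m<n∨m≡n i≤1+s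
... | inj₂ refl rewrite ≡ᵇ-refl (suc s) = cong (_+ g (suc s)) (trans
  (sumFrom1-cong s λ {j} _ j≤s → cong (if_then 0ℚ else g j) (sym (≢⇒≡ᵇ-false (ℕ.<⇒≢ (s≤s j≤s)))))
  (sym (ℚ.+-identityʳ _)))
... | inj₁ (s≤s i≤s) rewrite ≢⇒≡ᵇ-false (ℕ.<⇒≢ (s≤s i≤s) ∘ sym) =
  trans (cong (_+ g (suc s)) (sumFrom1-extract s g 1≤i i≤s))
    (solve 3 (λ a b c → (a :+ b) :+ c := (a :+ c) :+ b) refl (sumFrom1 s (λ j → if j ≡ᵇ i then 0ℚ else g j)) (g i) (g (suc s)))
  where open ℚ-Solver

prefix : ∀ {n} → ℕ → Vec ℕ n → Vec ℕ n
prefix {n} zero    y       = zeroV n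
prefix     (suc m) []      = []
prefix     (suc m) (a ∷ y) = a ∷ prefix m y

suffix : ∀ {n} → ℕ → Vec ℕ n → Vec ℕ n
suffix zero    y       = y
suffix (suc m) []      = []
suffix (suc m) (a ∷ y) = 0 ∷ suffix m y

prefix-zeroV : ∀ m n → prefix m (zeroV n) ≡ zeroV n
prefix-zeroV zero    n       = refl
prefix-zeroV (suc m) zero    = refl
prefix-zeroV (suc m) (suc n) = cong (0 ∷_) (prefix-zeroV m n)

suffix-zeroV : ∀ m n → suffix m (zeroV n) ≡ zeroV n
suffix-zeroV zero    n       = refl
suffix-zeroV (suc m) zero    = refl
suffix-zeroV (suc m) (suc n) = cong (0 ∷_) (suffix-zeroV m n)

prefix-prefix : ∀ {n} {k m} → k ≤ m → (y : Vec ℕ n) → prefix k (prefix m y) ≡ prefix k y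
prefix-prefix {k = zero}  _         y       = refl
prefix-prefix {k = suc k} (s≤s k≤m) []      = refl
prefix-prefix {k = suc k} (s≤s k≤m) (a ∷ y) = cong (a ∷_) (prefix-prefix k≤m y)

prefix-≡-mono : ∀ {n} {k m} → k ≤ m → {y y′ : Vec ℕ n} → prefix m y ≡ prefix m y′ → prefix k y ≡ prefix k y′
prefix-≡-mono {k = k} k≤m {y} {y′} e = trans (sym (prefix-prefix k≤m y)) (trans (cong (prefix k) e) (prefix-prefix k≤m y′))

prefix-suffix : ∀ {n} k m (y : Vec ℕ n) → prefix k (suffix m y) ≡ suffix m (prefix k y)
prefix-suffix {n} zero    m       y       = sym (suffix-zeroV m n)
prefix-suffix     (suc k) zero    y       = refl
prefix-suffix     (suc k) (suc m) []      = refl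
prefix-suffix     (suc k) (suc m) (a ∷ y) = cong (0 ∷_) (prefix-suffix k m y)

tabulate-0 : ∀ n → tabulate {n = n} (λ _ → 0) ≡ zeroV n
tabulate-0 zero    = refl
tabulate-0 (suc n) = cong (0 ∷_) (tabulate-0 n)

prefix-e : ∀ n {k m} → k < m → prefix m (e n k) ≡ e n k
prefix-e zero    {m = suc m} _         = refl
prefix-e (suc n) {zero}  {suc m} _     = cong (1 ∷_) (trans (cong (prefix m) (tabulate-0 n))
                                           (trans (prefix-zeroV m n) (sym (tabulate-0 n))))
prefix-e (suc n) {suc k} {suc m} (s≤s k<m) = cong (0 ∷_) (prefix-e n k<m)

dotℕ : ∀ {n} → Vec ℕ n → Vec ℕ n → ℕ
dotℕ a b = sum (toList (zipWith ℕ._*_ a b))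

dotℕ-zeroʳ : ∀ {n} (z : Vec ℕ n) → dotℕ z (zeroV n) ≡ 0
dotℕ-zeroʳ []      = refl
dotℕ-zeroʳ (c ∷ z) = trans (cong (ℕ._+ dotℕ z (zeroV _)) (ℕ.*-zeroʳ c)) (dotℕ-zeroʳ z)

dotℕ-zeroˡ : ∀ {n} (z : Vec ℕ n) → dotℕ (zeroV n) z ≡ 0
dotℕ-zeroˡ []      = refl
dotℕ-zeroˡ (c ∷ z) = dotℕ-zeroˡ z

dotℕ-prefix : ∀ {n} k (z ζ : Vec ℕ n) → dotℕ z (prefix k ζ) ≡ dotℕ (prefix k z) ζ
dotℕ-prefix zero    z       ζ       = trans (dotℕ-zeroʳ z) (sym (dotℕ-zeroˡ ζ))
dotℕ-prefix (suc k) []      []      = refl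
dotℕ-prefix (suc k) (a ∷ z) (c ∷ ζ) = cong (a ℕ.* c ℕ.+_) (dotℕ-prefix k z ζ)

takeV : ∀ {n} m → m ≤ n → Vec ℕ n → Vec ℕ m
takeV zero    _         y       = []
takeV (suc m) (s≤s m≤n) (a ∷ y) = a ∷ takeV m m≤n y

padTo-[] : ∀ n → padTo n [] ≡ zeroV n
padTo-[] zero    = refl
padTo-[] (suc n) = cong (0 ∷_) (padTo-[] n)

padTo-takeV : ∀ {n} m (m≤n : m ≤ n) (y : Vec ℕ n) → padTo n (takeV m m≤n y) ≡ prefix m y
padTo-takeV {n} zero    _         y       = padTo-[] n
padTo-takeV     (suc m) (s≤s m≤n) (a ∷ y) = cong (a ∷_) (padTo-takeV m m≤n y)

padTo-injective : ∀ n {m} → m ≤ n → {u v : Vec ℕ m} → padTo n u ≡ padTo n v → u ≡ v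
padTo-injective n       {zero}  _         {[]}    {[]}    _ = refl
padTo-injective (suc n) {suc m} (s≤s m≤n) {a ∷ u} {b ∷ v} e =
  cong₂ _∷_ (Vec.∷-injectiveˡ e) (padTo-injective n m≤n (Vec.∷-injectiveʳ e))

-- Parametrised by p − 1 so that `modp p` unfolds to `_% p`.
module ResidueVectors (p-1 : ℕ) where

  p : ℕ
  p = suc p-1

  Reduced : ∀ {n} → Vec ℕ n → Set
  Reduced = VAll.All (_< p)

  zeroV-reduced : ∀ n → Reduced (zeroV n)
  zeroV-reduced zero    = VAll.[]
  zeroV-reduced (suc n) = s≤s z≤n VAll.∷ zeroV-reduced n

  zeroPrefix : ∀ {n} → ℕ → Vec ℕ n → Bool
  zeroPrefix zero    z       = true
  zeroPrefix (suc m) []      = true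
  zeroPrefix (suc m) (c ∷ z) = (modp p c ≡ᵇ 0) ∧ zeroPrefix m z

  all-dot-e≡zeroPrefix : ∀ {n} m (z : Vec ℕ n) → all (λ k → dot p z (e n k) ≡ᵇ 0) (upTo m) ≡ zeroPrefix m z
  all-dot-e≡zeroPrefix zero    z       = refl
  all-dot-e≡zeroPrefix (suc m) []      = all-true (upTo (suc m))
  all-dot-e≡zeroPrefix {suc n} (suc m) (c ∷ z) = trans (all-upTo-suc m _) (cong₂ _∧_
    (cong (λ t → t % p ≡ᵇ 0) (trans (cong₂ ℕ._+_ (ℕ.*-identityʳ c) (trans (cong (dotℕ z) (tabulate-0 n)) (dotℕ-zeroʳ z))) (ℕ.+-identityʳ c)))
    (trans (all-ext _ _ (upTo m) λ k → cong (λ t → t % p ≡ᵇ 0) (cong (ℕ._+ dotℕ z (e n k)) (ℕ.*-zeroʳ c)))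
           (all-dot-e≡zeroPrefix m z)))

  inH≡zeroPrefix : ∀ n i (z : Vec ℕ n) → inH p n i z ≡ zeroPrefix (D p i) z
  inH≡zeroPrefix n i = all-dot-e≡zeroPrefix (D p i)

  +-p∸-%-≡0⇒≡ : ∀ {a d} → a < p → d < p → (a ℕ.+ (p ∸ d)) % p ≡ 0 → a ≡ d
  +-p∸-%-≡0⇒≡ {a} {d} a<p d<p eq with ℕ.<-cmp a d
  ... | tri≈ _ a≡d _ = a≡d
  ... | tri< a<d _ _ = ⊥-elim (ℕ.<⇒≢ (ℕ.m<n⇒0<n∸m d<p) (sym (ℕ.m+n≡0⇒n≡0 a (trans (sym (m<n⇒m%n≡m lt)) eq))))
    where
    lt : a ℕ.+ (p ∸ d) < p
    lt = ℕ.≤-trans (ℕ.+-monoˡ-< (p ∸ d) a<d) (ℕ.≤-reflexive (ℕ.m+[n∸m]≡n (ℕ.<⇒≤ d<p)))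
  ... | tri> _ _ d<a = ⊥-elim (ℕ.<⇒≢ (ℕ.m<n⇒0<n∸m d<a) (sym (begin
    a ∸ d                     ≡⟨ m<n⇒m%n≡m (ℕ.≤-<-trans (ℕ.m∸n≤m a d) a<p) ⟨
    (a ∸ d) % p               ≡⟨ [m+n]%n≡m%n (a ∸ d) p ⟨
    ((a ∸ d) ℕ.+ p) % p       ≡⟨ cong (_% p) shift ⟨
    (a ℕ.+ (p ∸ d)) % p       ≡⟨ eq ⟩
    0                         ∎)))
    where
    open ≡-Reasoning
    shift : a ℕ.+ (p ∸ d) ≡ (a ∸ d) ℕ.+ p
    shift = begin
      a ℕ.+ (p ∸ d)             ≡⟨ cong (ℕ._+ (p ∸ d)) (ℕ.m∸n+n≡m (ℕ.<⇒≤ d<a)) ⟨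
      ((a ∸ d) ℕ.+ d) ℕ.+ (p ∸ d) ≡⟨ ℕ.+-assoc (a ∸ d) d (p ∸ d) ⟩
      (a ∸ d) ℕ.+ (d ℕ.+ (p ∸ d)) ≡⟨ cong ((a ∸ d) ℕ.+_) (ℕ.m+[n∸m]≡n (ℕ.<⇒≤ d<p)) ⟩
      (a ∸ d) ℕ.+ p             ∎

  zeroPrefix-vsub-∷ : ∀ {n} m {a d} (y x : Vec ℕ n) → a < p → d < p →
    zeroPrefix (suc m) (vsub p (a ∷ y) (d ∷ x)) ≡ (a ≡ᵇ d) ∧ zeroPrefix m (vsub p y x)
  zeroPrefix-vsub-∷ m {a} {d} y x a<p d<p = cong (_∧ zeroPrefix m (vsub p y x)) (T-ext
    (λ t → ℕ.≡⇒≡ᵇ a d (+-p∸-%-≡0⇒≡ a<p d<p (ℕ.≡ᵇ⇒≡ _ 0 (subst T head≡ t))))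
    (λ t → subst T (sym head≡) (ℕ.≡⇒≡ᵇ _ 0 (same (ℕ.≡ᵇ⇒≡ a d t)))))
    where
    head≡ : (modp p (modp p (a ℕ.+ (p ∸ modp p d))) ≡ᵇ 0) ≡ ((a ℕ.+ (p ∸ d)) % p ≡ᵇ 0)
    head≡ = trans (cong (λ t → (a ℕ.+ (p ∸ t)) % p % p ≡ᵇ 0) (m<n⇒m%n≡m d<p))
                  (cong (_≡ᵇ 0) (m%n%n≡m%n (a ℕ.+ (p ∸ d)) p))
    same : a ≡ d → (a ℕ.+ (p ∸ d)) % p ≡ 0
    same refl = trans (cong (_% p) (ℕ.m+[n∸m]≡n (ℕ.<⇒≤ a<p))) (n%n≡0 p)

  allVecs-reduced : ∀ n → All Reduced (allVecs p n)
  allVecs-reduced zero    = VAll.[] ∷ []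
  allVecs-reduced (suc n) = All.concat⁺ (All.map⁺ (All.map
    (λ a<p → All.map⁺ (All.map (a<p VAll.∷_) (allVecs-reduced n))) (All.all-upTo p)))

  ∈-allVecs : ∀ {n} {v : Vec ℕ n} → Reduced v → v ∈ allVecs p n
  ∈-allVecs {zero}  {[]}    VAll.[]           = here refl
  ∈-allVecs {suc n} {a ∷ v} (a<p VAll.∷ v<p) =
    ∈.∈-concatMap⁺ (λ a → List.map (a ∷_) (allVecs p n)) (lose (∈.∈-upTo⁺ a<p) (∈.∈-map⁺ (a ∷_) (∈-allVecs v<p)))

  length-allVecs : ∀ n → length (allVecs p n) ≡ p ^ n
  length-allVecs zero    = refl
  length-allVecs (suc n) = trans (length-concatMap (upTo p) λ a →
    trans (List.length-map (a ∷_) (allVecs p n)) (length-allVecs n)) (cong (ℕ._* p ^ n) (List.length-upTo p))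
    where
    length-concatMap : (as : List ℕ) → (∀ a → length (List.map (a ∷_) (allVecs p n)) ≡ p ^ n) →
      length (concatMap (λ a → List.map (a ∷_) (allVecs p n)) as) ≡ length as ℕ.* p ^ n
    length-concatMap []       _ = refl
    length-concatMap (a ∷ as) ℓ = trans (List.length-++ (List.map (a ∷_) (allVecs p n)))
      (cong₂ ℕ._+_ (ℓ a) (length-concatMap as ℓ))

  allVecs-unique : ∀ n → Unique (allVecs p n)
  allVecs-unique zero    = [] AllPairs.∷ AllPairs.[]
  allVecs-unique (suc n) = unique-concat (upTo p) (Unique.upTo⁺ p)
    where
    V = allVecs p n
    head-∈ : ∀ {as} {y : Vec ℕ (suc n)} → y ∈ concatMap (λ a → List.map (a ∷_) V) as → Vec.head y ∈ as
    head-∈ {as} y∈ with a , a∈as , y∈aV ← find (∈.∈-concatMap⁻ (λ a → List.map (a ∷_) V) {xs = as} y∈)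
                   with _ , _ , refl ← ∈.∈-map⁻ (a ∷_) y∈aV = a∈as
    unique-concat : ∀ as → Unique as → Unique (concatMap (λ a → List.map (a ∷_) V) as)
    unique-concat []       _               = AllPairs.[]
    unique-concat (a ∷ as) (a∉as AllPairs.∷ u) =
      Unique.++⁺ (Unique.map⁺ Vec.∷-injectiveʳ (allVecs-unique n)) (unique-concat as u) disjoint
      where
      disjoint : ∀ {y} → ¬ (y ∈ List.map (a ∷_) V × y ∈ concatMap (λ a → List.map (a ∷_) V) as)
      disjoint (y∈aV , y∈rest) with _ , _ , refl ← ∈.∈-map⁻ (a ∷_) y∈aV = All.lookup a∉as (head-∈ y∈rest) refl

  ∑-allVecs-suc : ∀ n (h : Vec ℕ (suc n) → ℚ) →
    ∑ (allVecs p (suc n)) h ≡ ∑ (upTo p) (λ a → ∑ (allVecs p n) (h ∘ (a ∷_)))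
  ∑-allVecs-suc n h = trans (∑-concatMap (λ a → List.map (a ∷_) (allVecs p n)) (upTo p) h)
    (∑-ext (upTo p) (λ a → ∑-map (a ∷_) (allVecs p n) h))

  -- The coset x + ⟨e_1,…,e_m⟩^⊥: the vectors agreeing with x in their first m coordinates.
  coset : ∀ {n} → ℕ → Vec ℕ n → List (Vec ℕ n)
  coset {n} zero    x       = allVecs p n
  coset     (suc m) []      = [] ∷ []
  coset     (suc m) (d ∷ x) = List.map (d ∷_) (coset m x)

  length-coset : ∀ {n} m (x : Vec ℕ n) → length (coset m x) ≡ p ^ (n ∸ m)
  length-coset {n} zero    x       = length-allVecs n
  length-coset     (suc m) []      = refl
  length-coset     (suc m) (d ∷ x) = trans (List.length-map (d ∷_) (coset m x)) (length-coset m x)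

  coset-prefix : ∀ {n} m {x : Vec ℕ n} → Reduced x → All (λ y → Reduced y × prefix m y ≡ prefix m x) (coset m x)
  coset-prefix {n} zero    _                   = All.map (_, refl) (allVecs-reduced n)
  coset-prefix     (suc m) {[]}    _           = (VAll.[] , refl) ∷ []
  coset-prefix     (suc m) {d ∷ x} (d<p VAll.∷ x<p) =
    All.map⁺ (All.map (λ (y<p , e) → (d<p VAll.∷ y<p) , cong (d ∷_) e) (coset-prefix m x<p))

  filter-zeroPrefix-vsub : ∀ n m {x : Vec ℕ n} → Reduced x →
    filterᵇ (λ y → zeroPrefix m (vsub p y x)) (allVecs p n) ≡ coset m x
  filter-zeroPrefix-vsub zero    zero    {[]} _ = refl
  filter-zeroPrefix-vsub zero    (suc m) {[]} _ = refl
  filter-zeroPrefix-vsub (suc n) zero    _      = filterᵇ-all _ _ (λ _ → refl)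
  filter-zeroPrefix-vsub (suc n) (suc m) {d ∷ x} (d<p VAll.∷ x<p) = begin
    filterᵇ F (concatMap (λ a → List.map (a ∷_) (allVecs p n)) (upTo p))
      ≡⟨ filterᵇ-concatMap F (λ a → List.map (a ∷_) (allVecs p n)) (upTo p) ⟩
    concatMap (λ a → filterᵇ F (List.map (a ∷_) (allVecs p n))) (upTo p)
      ≡⟨ concatMap-cong-All (All.map slice (All.all-upTo p)) ⟩
    concatMap (λ a → if a ≡ᵇ d then List.map (d ∷_) (coset m x) else []) (upTo p)
      ≡⟨ concatMap-if-≡ᵇ _ (upTo p) (Unique.upTo⁺ p) (∈.∈-upTo⁺ d<p) ⟩
    List.map (d ∷_) (coset m x) ∎
    where
    open ≡-Reasoning
    F : Vec ℕ (suc n) → Bool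
    F y = zeroPrefix (suc m) (vsub p y (d ∷ x))
    slice : ∀ {a} → a < p →
      filterᵇ F (List.map (a ∷_) (allVecs p n)) ≡ (if a ≡ᵇ d then List.map (d ∷_) (coset m x) else [])
    slice {a} a<p with a ℕ.≟ d
    ... | yes refl rewrite ≡ᵇ-refl a = trans (filterᵇ-map F (a ∷_) (allVecs p n))
          (cong (List.map (a ∷_)) (trans (filterᵇ-cong _ _ (allVecs p n) λ y →
              trans (zeroPrefix-vsub-∷ m y x a<p d<p) (cong (_∧ zeroPrefix m (vsub p y x)) (≡ᵇ-refl a)))
            (filter-zeroPrefix-vsub n m x<p)))
    ... | no a≢d rewrite ≢⇒≡ᵇ-false a≢d = trans (filterᵇ-map F (a ∷_) (allVecs p n))
          (cong (List.map (a ∷_)) (filterᵇ-none _ (allVecs p n) λ y →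
            trans (zeroPrefix-vsub-∷ m y x a<p d<p) (cong (_∧ zeroPrefix m (vsub p y x)) (≢⇒≡ᵇ-false a≢d))))

  zeroPrefix-vsub-prefix : ∀ M {n} {y : Vec ℕ n} → Reduced y → T (zeroPrefix M (vsub p y (prefix M y)))
  zeroPrefix-vsub-prefix zero    _                   = _
  zeroPrefix-vsub-prefix (suc M) {y = []}    _       = _
  zeroPrefix-vsub-prefix (suc M) {y = a ∷ y} (a<p VAll.∷ y<p) rewrite zeroPrefix-vsub-∷ M y (prefix M y) a<p a<p
    | ≡ᵇ-refl a = zeroPrefix-vsub-prefix M y<p

  zeroPrefix-vsub-padTo : ∀ M n {y : Vec ℕ n} {v : Vec ℕ M} → Reduced y → Reduced v →
    T (zeroPrefix M (vsub p y (padTo n v))) → padTo n v ≡ prefix M y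
  zeroPrefix-vsub-padTo zero    n       {v = []} _ _ _ = padTo-[] n
  zeroPrefix-vsub-padTo (suc M) zero    {[]}     _ _ _ = refl
  zeroPrefix-vsub-padTo (suc M) (suc n) {a ∷ y} {c ∷ v} (a<p VAll.∷ y<p) (c<p VAll.∷ v<p) t
    rewrite zeroPrefix-vsub-∷ M y (padTo n v) a<p c<p
    with a≡c , rest ← Equivalence.to T-∧ t rewrite ℕ.≡ᵇ⇒≡ a c a≡c =
    cong (c ∷_) (zeroPrefix-vsub-padTo M n y<p v<p rest)

  vsub-prefix : ∀ M {n} {y : Vec ℕ n} → Reduced y → vsub p y (prefix M y) ≡ suffix M y
  vsub-prefix zero    {y = []}    _                = refl
  vsub-prefix zero    {y = a ∷ y} (a<p VAll.∷ y<p) =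
    cong₂ _∷_ (trans ([m+n]%n≡m%n a p) (m<n⇒m%n≡m a<p)) (vsub-prefix zero y<p)
  vsub-prefix (suc M) {y = []}    _                = refl
  vsub-prefix (suc M) {y = a ∷ y} (a<p VAll.∷ y<p) = cong₂ _∷_
    (trans (cong (λ k → (a ℕ.+ (p ∸ k)) % p) (m<n⇒m%n≡m a<p))
      (trans (cong (_% p) (ℕ.m+[n∸m]≡n (ℕ.<⇒≤ a<p))) (n%n≡0 p)))
    (vsub-prefix M y<p)

  prefix-∈-padTo-allVecs : ∀ M {n} → M ≤ n → {y : Vec ℕ n} → Reduced y →
    prefix M y ∈ List.map (padTo n) (allVecs p M)
  prefix-∈-padTo-allVecs M M≤n {y} y<p =
    subst (_∈ List.map (padTo _) (allVecs p M)) (padTo-takeV M M≤n y)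
      (∈.∈-map⁺ (padTo _) (∈-allVecs (takeV-reduced M M≤n y<p)))
    where
    takeV-reduced : ∀ {n} m (m≤n : m ≤ n) {y : Vec ℕ n} → Reduced y → Reduced (takeV m m≤n y)
    takeV-reduced zero    _         _                = VAll.[]
    takeV-reduced (suc m) (s≤s m≤n) (a<p VAll.∷ y<p) = a<p VAll.∷ takeV-reduced m m≤n y<p

  ∑-coset-const : ∀ {n} m (h : Vec ℕ n → ℚ) {x : Vec ℕ n} → Reduced x →
    (∀ {y} → Reduced y → prefix m y ≡ prefix m x → h y ≡ h x) →
    ∑ (coset m x) h ≡ h x * fromℕ (p ^ (n ∸ m))
  ∑-coset-const m h {x} x<p h-const =
    trans (∑-cong (All.map (λ (y<p , e) → h-const y<p e) (coset-prefix m x<p)))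
      (trans (∑-const (coset m x) (h x)) (cong (λ k → h x * fromℕ k) (length-coset m x)))

  ∑-coset-tower : ∀ {n} m M (h : Vec ℕ n → ℚ) (c : ℚ) → m ≤ M → M ≤ n →
    (∀ {x′} → Reduced x′ → ∑ (coset M x′) h ≡ c) →
    ∀ {x} → Reduced x → ∑ (coset m x) h ≡ c * fromℕ (p ^ (M ∸ m))
  ∑-coset-tower zero zero h c _ _ fine x<p = trans (fine x<p) (trans (sym (ℚ.*-identityʳ c)) (cong (c *_) (sym fromℕ-1)))
  ∑-coset-tower {suc n} zero (suc M) h c _ (s≤s M≤n) fine x<p = begin
    ∑ (allVecs p (suc n)) h                                   ≡⟨ ∑-allVecs-suc n h ⟩
    ∑ (upTo p) (λ a → ∑ (allVecs p n) (h ∘ (a ∷_)))           ≡⟨ ∑-cong (All.map slice (All.all-upTo p)) ⟩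
    ∑ (upTo p) (λ _ → c * fromℕ (p ^ M))                      ≡⟨ ∑-const (upTo p) (c * fromℕ (p ^ M)) ⟩
    c * fromℕ (p ^ M) * fromℕ (length (upTo p))                ≡⟨ cong (λ k → c * fromℕ (p ^ M) * fromℕ k) (List.length-upTo p) ⟩
    c * fromℕ (p ^ M) * fromℕ p                               ≡⟨ ℚ.*-assoc c (fromℕ (p ^ M)) (fromℕ p) ⟩
    c * (fromℕ (p ^ M) * fromℕ p)                             ≡⟨ cong (c *_) (trans (ℚ.*-comm (fromℕ (p ^ M)) (fromℕ p)) (sym (fromℕ-* p (p ^ M)))) ⟩
    c * fromℕ (p ^ suc M)                                     ∎
    where
    open ≡-Reasoning
    slice : ∀ {a} → a < p → ∑ (allVecs p n) (h ∘ (a ∷_)) ≡ c * fromℕ (p ^ M)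
    slice a<p = ∑-coset-tower zero M (h ∘ (_ ∷_)) c z≤n M≤n
      (λ {x′} x′<p → trans (sym (∑-map (_ ∷_) (coset M x′) h)) (fine (a<p VAll.∷ x′<p))) (zeroV-reduced n)
  ∑-coset-tower (suc m) (suc M) h c (s≤s m≤M) (s≤s M≤n) fine {d ∷ x} (d<p VAll.∷ x<p) =
    trans (∑-map (d ∷_) (coset m x) h) (∑-coset-tower m M (h ∘ (d ∷_)) c m≤M M≤n
      (λ {x′} x′<p → trans (sym (∑-map (d ∷_) (coset M x′) h)) (fine (d<p VAll.∷ x′<p))) x<p)

  prefix-vadd : ∀ {n} K (a b : Vec ℕ n) → prefix K (vadd p a b) ≡ vadd p (prefix K a) (prefix K b)
  prefix-vadd {n} zero    a       b       = sym (vadd-zeroV n)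
    where
    vadd-zeroV : ∀ n → vadd p (zeroV n) (zeroV n) ≡ zeroV n
    vadd-zeroV zero    = refl
    vadd-zeroV (suc n) = cong (0 ∷_) (vadd-zeroV n)
  prefix-vadd     (suc K) []      []      = refl
  prefix-vadd     (suc K) (x ∷ a) (y ∷ b) = cong (_ ∷_) (prefix-vadd K a b)

  prefix-vscale : ∀ {n} K c (a : Vec ℕ n) → prefix K (vscale p c a) ≡ vscale p c (prefix K a)
  prefix-vscale {n} zero    c a       = sym (vscale-zeroV n)
    where
    vscale-zeroV : ∀ n → vscale p c (zeroV n) ≡ zeroV n
    vscale-zeroV zero    = refl
    vscale-zeroV (suc n) = cong₂ _∷_ (cong (_% p) (ℕ.*-zeroʳ c)) (vscale-zeroV n)
  prefix-vscale     (suc K) c []      = refl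
  prefix-vscale     (suc K) c (x ∷ a) = cong (_ ∷_) (prefix-vscale K c a)

  prefix-lincomb : ∀ {n} K (cs : List ℕ) {vs : List (Vec ℕ n)} → All (λ v → prefix K v ≡ v) vs →
    prefix K (lincomb p cs vs) ≡ lincomb p cs vs
  prefix-lincomb {n} K []       _        = prefix-zeroV K n
  prefix-lincomb {n} K (c ∷ cs) []       = prefix-zeroV K n
  prefix-lincomb     K (c ∷ cs) (e ∷ es) = trans (prefix-vadd K (vscale p c _) (lincomb p cs _))
    (cong₂ (vadd p) (trans (prefix-vscale K c _) (cong (vscale p c) e)) (prefix-lincomb K cs es))

  vadd-1·-zeroV : ∀ {n} {v : Vec ℕ n} → Reduced v → vadd p (vscale p 1 v) (zeroV n) ≡ v
  vadd-1·-zeroV VAll.[]            = refl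
  vadd-1·-zeroV {v = a ∷ v} (a<p VAll.∷ v<p) = cong₂ _∷_
    (trans (cong (_% p) (ℕ.+-identityʳ ((1 ℕ.* a) % p)))
      (trans (m%n%n≡m%n (1 ℕ.* a) p) (trans (cong (_% p) (ℕ.*-identityˡ a)) (m<n⇒m%n≡m a<p))))
    (vadd-1·-zeroV v<p)

  vadd-0· : ∀ {n} (w : Vec ℕ n) {v : Vec ℕ n} → Reduced v → vadd p (vscale p 0 w) v ≡ v
  vadd-0· []      VAll.[]            = refl
  vadd-0· (b ∷ w) (a<p VAll.∷ v<p) = cong₂ _∷_ (m<n⇒m%n≡m a<p) (vadd-0· w v<p)

  lincomb-replicate-0 : ∀ {n} k (vs : List (Vec ℕ n)) → lincomb p (List.replicate k 0) vs ≡ zeroV n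
  lincomb-replicate-0     zero    vs       = refl
  lincomb-replicate-0     (suc k) []       = refl
  lincomb-replicate-0 {n} (suc k) (v ∷ vs) =
    trans (cong (vadd p (vscale p 0 v)) (lincomb-replicate-0 k vs)) (vadd-0· v (zeroV-reduced n))

  ∈⇒InSpan : ∀ {n} {v : Vec ℕ n} {vs : List (Vec ℕ n)} → Reduced v → v ∈ vs → InSpan p vs v
  ∈⇒InSpan {vs = v ∷ vs} v<p (here refl) =
    1 ∷ List.replicate (length vs) 0 , cong suc (List.length-replicate (length vs)) ,
    trans (cong (vadd p (vscale p 1 v)) (lincomb-replicate-0 (length vs) vs)) (vadd-1·-zeroV v<p)
  ∈⇒InSpan {vs = w ∷ vs} v<p (there v∈vs) with cs , ℓ , e ← ∈⇒InSpan v<p v∈vs =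
    0 ∷ cs , cong suc ℓ , trans (cong (vadd p (vscale p 0 w)) e) (vadd-0· w v<p)

%-≡⇒∣∸ : ∀ {p} .{{_ : ℕ.NonZero p}} x y → x % p ≡ y % p → y ≤ x → p ∣ (x ∸ y)
%-≡⇒∣∸ {p} x y e y≤x = divides (x / p ∸ y / p) (begin
  x ∸ y                                              ≡⟨ cong₂ _∸_ (m≡m%n+[m/n]*n x p) (m≡m%n+[m/n]*n y p) ⟩
  (x % p ℕ.+ (x / p) ℕ.* p) ∸ (y % p ℕ.+ (y / p) ℕ.* p) ≡⟨ cong (λ r → (r ℕ.+ (x / p) ℕ.* p) ∸ (y % p ℕ.+ (y / p) ℕ.* p)) e ⟩
  (y % p ℕ.+ (x / p) ℕ.* p) ∸ (y % p ℕ.+ (y / p) ℕ.* p) ≡⟨ ℕ.[m+n]∸[m+o]≡n∸o (y % p) _ _ ⟩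
  (x / p) ℕ.* p ∸ (y / p) ℕ.* p                      ≡⟨ ℕ.*-distribʳ-∸ p (x / p) (y / p) ⟨
  (x / p ∸ y / p) ℕ.* p                              ∎)
  where open ≡-Reasoning

%-cong-+ : ∀ {p} .{{_ : ℕ.NonZero p}} {x x′ y y′} → x % p ≡ x′ % p → y % p ≡ y′ % p → (x ℕ.+ y) % p ≡ (x′ ℕ.+ y′) % p
%-cong-+ {p} {x} {x′} {y} {y′} ex ey =
  trans (%-distribˡ-+ x y p) (trans (cong₂ (λ u v → (u ℕ.+ v) % p) ex ey) (sym (%-distribˡ-+ x′ y′ p)))

%-cong-* : ∀ {p} .{{_ : ℕ.NonZero p}} {x x′ y y′} → x % p ≡ x′ % p → y % p ≡ y′ % p → (x ℕ.* y) % p ≡ (x′ ℕ.* y′) % p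
%-cong-* {p} {x} {x′} {y} {y′} ex ey =
  trans (%-distribˡ-* x y p) (trans (cong₂ (λ u v → (u ℕ.* v) % p) ex ey) (sym (%-distribˡ-* x′ y′ p)))

module AffineMaps (p-1 : ℕ) (p-prime : Prime (suc p-1)) {c : ℕ} (c<p : c < suc p-1) (c≢0 : ¬ c ≡ 0) where

  open ResidueVectors p-1 using (p)

  coprime : Coprime p c
  coprime = prime⇒coprime p-prime {{ℕ.≢-nonZero c≢0}} c<p

  private
    affine-injective-≤ : ∀ b {a a′} → a < p → a′ ≤ a → (b ℕ.+ a ℕ.* c) % p ≡ (b ℕ.+ a′ ℕ.* c) % p → a ≡ a′
    affine-injective-≤ b {a} {a′} a<p a′≤a e = ℕ.≤-antisym (ℕ.m∸n≡0⇒m≤n a∸a′≡0) a′≤a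
      where
      p∣c[a∸a′] : p ∣ c ℕ.* (a ∸ a′)
      p∣c[a∸a′] = subst (p ∣_)
        (trans (ℕ.[m+n]∸[m+o]≡n∸o b _ _) (trans (sym (ℕ.*-distribʳ-∸ c a a′)) (ℕ.*-comm (a ∸ a′) c)))
        (%-≡⇒∣∸ _ _ e (ℕ.+-monoʳ-≤ b (ℕ.*-monoˡ-≤ c a′≤a)))
      a∸a′≡0 : a ∸ a′ ≡ 0
      a∸a′≡0 = trans (sym (m<n⇒m%n≡m (ℕ.≤-<-trans (ℕ.m∸n≤m a a′) a<p)))
                     (n∣m⇒m%n≡0 _ p (coprime-divisor coprime p∣c[a∸a′]))

  affine-injective : ∀ b {a a′} → a < p → a′ < p → (b ℕ.+ a ℕ.* c) % p ≡ (b ℕ.+ a′ ℕ.* c) % p → a ≡ a′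
  affine-injective b a<p a′<p e with ℕ.≤-total _ _
  ... | inj₁ a′≤a = affine-injective-≤ b a<p a′≤a e
  ... | inj₂ a≤a′ = sym (affine-injective-≤ b a′<p a≤a′ (sym e))

  1%p≡1 : 1 % p ≡ 1
  1%p≡1 = m<n⇒m%n≡m (ℕ.nonTrivial⇒n>1 p {{prime⇒nonTrivial p-prime}})

  inverse : ∃ λ z → (z ℕ.* c) % p ≡ 1
  inverse with coprime-Bézout (Coprime.sym coprime)
  ... | Bézout.+- x y eq = x , trans (cong (_% p) (sym eq)) (trans ([m+kn]%n≡m%n 1 y p) 1%p≡1)
  ... | Bézout.-+ x y eq = (p ∸ 1) ℕ.* x , (begin
    zc % p                       ≡⟨ [m+n]%n≡m%n zc p ⟨
    (zc ℕ.+ p) % p               ≡⟨ cong (_% p) (solve 2 (λ z P → z :+ (con 1 :+ P) := (z :+ P) :+ con 1) refl zc (p ∸ 1)) ⟩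
    ((zc ℕ.+ (p ∸ 1)) ℕ.+ 1) % p ≡⟨ %-cong-+ {x = zc ℕ.+ (p ∸ 1)} {0} {1} {1} (trans (cong (_% p) multiple) (m*n%n≡0 ((p ∸ 1) ℕ.* y) p)) refl ⟩
    1 % p                        ≡⟨ 1%p≡1 ⟩
    1                            ∎)
    where
    open ≡-Reasoning
    open ℕ-Solver
    zc = ((p ∸ 1) ℕ.* x) ℕ.* c
    multiple : zc ℕ.+ (p ∸ 1) ≡ ((p ∸ 1) ℕ.* y) ℕ.* p
    multiple = begin
      zc ℕ.+ (p ∸ 1)              ≡⟨ solve 3 (λ P x c → (P :* x) :* c :+ P := P :* (con 1 :+ x :* c)) refl (p ∸ 1) x c ⟩
      (p ∸ 1) ℕ.* (1 ℕ.+ x ℕ.* c) ≡⟨ cong ((p ∸ 1) ℕ.*_) eq ⟩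
      (p ∸ 1) ℕ.* (y ℕ.* p)       ≡⟨ ℕ.*-assoc (p ∸ 1) y p ⟨
      ((p ∸ 1) ℕ.* y) ℕ.* p       ∎

  affine-surjective : ∀ b {t} → t < p → ∃ λ a → a < p × (b ℕ.+ a ℕ.* c) % p ≡ t
  affine-surjective b {t} t<p = a , m%n<n (z ℕ.* k) p , (begin
    (b ℕ.+ a ℕ.* c) % p       ≡⟨ %-cong-+ {x = b} {b % p} {a ℕ.* c} {k} (sym (m%n%n≡m%n b p)) a·c≡k ⟩
    (b % p ℕ.+ k) % p         ≡⟨ cong (_% p) (solve 3 (λ r t s → r :+ (t :+ s) := t :+ (r :+ s)) refl (b % p) t (p ∸ b % p)) ⟩
    (t ℕ.+ (b % p ℕ.+ (p ∸ b % p))) % p ≡⟨ cong (λ v → (t ℕ.+ v) % p) (ℕ.m+[n∸m]≡n (m%n≤n b p)) ⟩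
    (t ℕ.+ p) % p             ≡⟨ [m+n]%n≡m%n t p ⟩
    t % p                     ≡⟨ m<n⇒m%n≡m t<p ⟩
    t                         ∎)
    where
    open ≡-Reasoning
    open ℕ-Solver
    z = proj₁ inverse
    k = t ℕ.+ (p ∸ b % p)
    a = (z ℕ.* k) % p
    a·c≡k : (a ℕ.* c) % p ≡ k % p
    a·c≡k = begin
      (a ℕ.* c) % p         ≡⟨ %-cong-* {x = a} {z ℕ.* k} {c} {c} (m%n%n≡m%n (z ℕ.* k) p) refl ⟩
      ((z ℕ.* k) ℕ.* c) % p ≡⟨ cong (_% p) (solve 3 (λ z k c → (z :* k) :* c := k :* (z :* c)) refl z k c) ⟩
      (k ℕ.* (z ℕ.* c)) % p ≡⟨ %-cong-* {x = k} {k} {z ℕ.* c} {1} refl (trans (proj₂ inverse) (sym 1%p≡1)) ⟩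
      (k ℕ.* 1) % p         ≡⟨ cong (_% p) (ℕ.*-identityʳ k) ⟩
      k % p                 ∎

  ∑-affine-hits : ∀ b {t} → t < p → ∑ (upTo p) (λ a → indicator ((b ℕ.+ a ℕ.* c) % p ≡ᵇ t)) ≡ 1ℚ
  ∑-affine-hits b {t} t<p with a₀ , a₀<p , hits ← affine-surjective b t<p =
    trans (∑-cong (All.map only-a₀ (All.all-upTo p))) (∑-indicator-≡ᵇ (upTo p) (Unique.upTo⁺ p) (∈.∈-upTo⁺ a₀<p))
    where
    only-a₀ : ∀ {a} → a < p → indicator ((b ℕ.+ a ℕ.* c) % p ≡ᵇ t) ≡ indicator (a ≡ᵇ a₀)
    only-a₀ {a} a<p = cong indicator (T-ext
      (λ h → ℕ.≡⇒≡ᵇ a a₀ (affine-injective b a<p a₀<p (trans (ℕ.≡ᵇ⇒≡ _ t h) (sym hits))))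
      (λ a≡a₀ → ℕ.≡⇒≡ᵇ _ t (subst (λ a → (b ℕ.+ a ℕ.* c) % p ≡ t) (sym (ℕ.≡ᵇ⇒≡ a a₀ a≡a₀)) hits)))

module LinearForms (p-1 : ℕ) (p-prime : Prime (suc p-1)) where

  open ResidueVectors p-1

  ∑-linearForm-hits : ∀ n {ζ : Vec ℕ n} → Reduced ζ → ¬ ζ ≡ zeroV n → ∀ b {t} → t < p →
    ∑ (allVecs p n) (λ y → indicator ((b ℕ.+ dotℕ y ζ) % p ≡ᵇ t)) * fromℕ p ≡ fromℕ (p ^ n)
  ∑-linearForm-hits zero    {[]} _ ζ≢0 = ⊥-elim (ζ≢0 refl)
  ∑-linearForm-hits (suc n) {c ∷ ζ} (c<p VAll.∷ ζ<p) cζ≢0 b {t} t<p =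
    trans (cong (_* fromℕ p) by-first-coordinate) (by-tail (Vec.≡-dec ℕ._≟_ ζ (zeroV n)))
    where
    hits : ℕ → Vec ℕ n → ℚ
    hits a y = indicator (((b ℕ.+ a ℕ.* c) ℕ.+ dotℕ y ζ) % p ≡ᵇ t)
    by-first-coordinate : ∑ (allVecs p (suc n)) (λ y → indicator ((b ℕ.+ dotℕ y (c ∷ ζ)) % p ≡ᵇ t))
                        ≡ ∑ (upTo p) (λ a → ∑ (allVecs p n) (hits a))
    by-first-coordinate = trans (∑-allVecs-suc n _) (∑-ext (upTo p) λ a → ∑-ext (allVecs p n) λ y →
      cong (λ v → indicator (v % p ≡ᵇ t)) (sym (ℕ.+-assoc b (a ℕ.* c) (dotℕ y ζ))))
    p^n·p≡p^[1+n] : fromℕ (p ^ n) * fromℕ p ≡ fromℕ (p ^ suc n)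
    p^n·p≡p^[1+n] = trans (ℚ.*-comm (fromℕ (p ^ n)) (fromℕ p)) (sym (fromℕ-* p (p ^ n)))
    by-tail : Dec (ζ ≡ zeroV n) → ∑ (upTo p) (λ a → ∑ (allVecs p n) (hits a)) * fromℕ p ≡ fromℕ (p ^ suc n)
    by-tail (yes refl) = begin
      ∑ (upTo p) (λ a → ∑ (allVecs p n) (hits a)) * fromℕ p
        ≡⟨ cong (_* fromℕ p) (∑-ext (upTo p) constant-in-tail) ⟩
      ∑ (upTo p) (λ a → indicator ((b ℕ.+ a ℕ.* c) % p ≡ᵇ t) * fromℕ (p ^ n)) * fromℕ p
        ≡⟨ cong (_* fromℕ p) (∑-*ʳ (upTo p) (λ a → indicator ((b ℕ.+ a ℕ.* c) % p ≡ᵇ t)) (fromℕ (p ^ n))) ⟩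
      ∑ (upTo p) (λ a → indicator ((b ℕ.+ a ℕ.* c) % p ≡ᵇ t)) * fromℕ (p ^ n) * fromℕ p
        ≡⟨ cong (λ z → z * fromℕ (p ^ n) * fromℕ p) (AffineMaps.∑-affine-hits p-1 p-prime c<p c≢0 b t<p) ⟩
      1ℚ * fromℕ (p ^ n) * fromℕ p
        ≡⟨ cong (_* fromℕ p) (ℚ.*-identityˡ (fromℕ (p ^ n))) ⟩
      fromℕ (p ^ n) * fromℕ p
        ≡⟨ p^n·p≡p^[1+n] ⟩
      fromℕ (p ^ suc n) ∎
      where
      open ≡-Reasoning
      c≢0 : ¬ c ≡ 0
      c≢0 refl = cζ≢0 refl
      constant-in-tail : ∀ a → ∑ (allVecs p n) (hits a) ≡ indicator ((b ℕ.+ a ℕ.* c) % p ≡ᵇ t) * fromℕ (p ^ n)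
      constant-in-tail a = trans
        (∑-ext (allVecs p n) λ y → cong (λ v → indicator (v % p ≡ᵇ t))
          (trans (cong ((b ℕ.+ a ℕ.* c) ℕ.+_) (dotℕ-zeroʳ y)) (ℕ.+-identityʳ _)))
        (trans (∑-const (allVecs p n) hit) (cong (λ k → hit * fromℕ k) (length-allVecs n)))
        where hit = indicator ((b ℕ.+ a ℕ.* c) % p ≡ᵇ t)
    by-tail (no ζ≢0) = begin
      ∑ (upTo p) (λ a → ∑ (allVecs p n) (hits a)) * fromℕ p
        ≡⟨ ∑-*ʳ (upTo p) (λ a → ∑ (allVecs p n) (hits a)) (fromℕ p) ⟨
      ∑ (upTo p) (λ a → ∑ (allVecs p n) (hits a) * fromℕ p)
        ≡⟨ ∑-ext (upTo p) (λ a → ∑-linearForm-hits n ζ<p ζ≢0 (b ℕ.+ a ℕ.* c) t<p) ⟩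
      ∑ (upTo p) (λ _ → fromℕ (p ^ n))
        ≡⟨ ∑-const (upTo p) (fromℕ (p ^ n)) ⟩
      fromℕ (p ^ n) * fromℕ (length (upTo p))
        ≡⟨ cong (λ k → fromℕ (p ^ n) * fromℕ k) (List.length-upTo p) ⟩
      fromℕ (p ^ n) * fromℕ p
        ≡⟨ p^n·p≡p^[1+n] ⟩
      fromℕ (p ^ suc n) ∎
      where open ≡-Reasoning

  ∑-coset-kernel : ∀ M {n} (x : Vec ℕ n) {ζ : Vec ℕ n} → Reduced ζ → ¬ ζ ≡ zeroV n → T (zeroPrefix M ζ) →
    ∑ (coset M x) (λ y → indicator (dot p (suffix M y) ζ ≡ᵇ 0)) * fromℕ p ≡ fromℕ (p ^ (n ∸ M))
  ∑-coset-kernel zero    {n} x ζ<p ζ≢0 _ = ∑-linearForm-hits n ζ<p ζ≢0 0 (s≤s z≤n)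
  ∑-coset-kernel (suc M) [] {[]} _ ζ≢0 _ = ⊥-elim (ζ≢0 refl)
  ∑-coset-kernel (suc M) (d ∷ x) {c ∷ ζ} (c<p VAll.∷ ζ<p) cζ≢0 t
    with c%p≡0 , ζ-zeroPrefix ← Equivalence.to T-∧ t =
    trans (cong (_* fromℕ p) (∑-map (d ∷_) (coset M x) _)) (∑-coset-kernel M x ζ<p ζ≢0 ζ-zeroPrefix)
    where
    ζ≢0 : ¬ ζ ≡ zeroV _
    ζ≢0 ζ≡0 = cζ≢0 (cong₂ _∷_ (trans (sym (m<n⇒m%n≡m c<p)) (ℕ.≡ᵇ⇒≡ _ 0 c%p≡0)) ζ≡0)

D-mono : ∀ p {a b} → a ≤ b → D p a ≤ D p b
D-mono p {a} {zero}  z≤n  = ℕ.≤-refl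
D-mono p {a} {suc b} a≤1+b with ℕ.m≤n⇒m<n∨m≡n a≤1+b
... | inj₁ (s≤s a≤b) = ℕ.≤-trans (D-mono p a≤b) (ℕ.m≤m+n (D p b) (d p (suc b)))
... | inj₂ refl      = ℕ.≤-refl

module Construction (p-1 : ℕ) (p-prime : Prime (suc p-1)) (n s : ℕ) (Ds≤n : D (suc p-1) s ≤ n)
  (ξ : ℕ → Vec ℕ n → Vec ℕ n) (valid : ValidX (suc p-1) n s ξ) (spanning : SpanningX (suc p-1) n s ξ)
  (w : ℕ → ℚ) where

  open ResidueVectors p-1
  open LinearForms p-1 p-prime

  ρ : ℚ
  ρ = recipℕ p

  p·ρ≡1 : fromℕ p * ρ ≡ 1ℚ
  p·ρ≡1 = fromℕ-*-recipℕ p (s≤s z≤n)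

  𝟙A : ℕ → Vec ℕ n → ℚ
  𝟙A j y = indicator (inA p n j (ξ j) y)

  D≤n : ∀ {j} → j ≤ s → D p j ≤ n
  D≤n j≤s = ℕ.≤-trans (D-mono p j≤s) Ds≤n

  D[j∸1]≤D[j] : ∀ j → D p (j ∸ 1) ≤ D p j
  D[j∸1]≤D[j] j = D-mono p (ℕ.m∸n≤m j 1)

  D[j∸1]≤n : ∀ {j} → j ≤ s → D p (j ∸ 1) ≤ n
  D[j∸1]≤n {j} j≤s = ℕ.≤-trans (D[j∸1]≤D[j] j) (D≤n j≤s)

  inA≡suffix-dot : ∀ j {y} → j ≤ s → Reduced y →
    inA p n j (ξ j) y ≡ (dot p (suffix (D p (j ∸ 1)) y) (ξ j (prefix (D p (j ∸ 1)) y)) ≡ᵇ 0)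
  inA≡suffix-dot j {y} j≤s y<p =
    trans (any-∧-unique (allU p n (j ∸ 1)) P Q (prefix-∈-padTo-allVecs M (D[j∸1]≤n j≤s) y<p) P-prefix P-unique)
          (cong (λ z → dot p z (ξ j (prefix M y)) ≡ᵇ 0) (vsub-prefix M y<p))
    where
    M = D p (j ∸ 1)
    P Q : Vec ℕ n → Bool
    P u = inH p n (j ∸ 1) (vsub p y u)
    Q u = dot p (vsub p y u) (ξ j u) ≡ᵇ 0
    P-prefix : T (P (prefix M y))
    P-prefix = subst T (sym (inH≡zeroPrefix n (j ∸ 1) _)) (zeroPrefix-vsub-prefix M y<p)
    P-unique : ∀ {u} → u ∈ allU p n (j ∸ 1) → T (P u) → u ≡ prefix M y
    P-unique u∈ Pu with v , v∈ , refl ← ∈.∈-map⁻ (padTo n) u∈ =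
      zeroPrefix-vsub-padTo M n y<p (All.lookup (allVecs-reduced M) v∈) (subst T (inH≡zeroPrefix n (j ∸ 1) _) Pu)

  module _ {j} (1≤j : 1 ≤ j) (j≤s : j ≤ s) where

    private
      M = D p (j ∸ 1)

    ξ-valid : ∀ {y} → Reduced y →
      Reduced (ξ j (prefix M y)) × ¬ ξ j (prefix M y) ≡ zeroV n × T (zeroPrefix M (ξ j (prefix M y)))
    ξ-valid y<p with ξ∈ , ξ≢0 , ξ∈H ← valid j 1≤j j≤s _ (prefix-∈-padTo-allVecs M (D[j∸1]≤n j≤s) y<p) =
      All.lookup (allVecs-reduced n) ξ∈ , ξ≢0 , subst T (inH≡zeroPrefix n (j ∸ 1) _) (Equivalence.from T-≡ ξ∈H)

    ξ-supported : ∀ {y} → Reduced y → prefix (D p j) (ξ j (prefix M y)) ≡ ξ j (prefix M y)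
    ξ-supported {y} y<p = supported (Equivalence.to (spanning j 1≤j j≤s U U-unique (All.tabulate id) ¾|U|≤|U| v v∈)
                                             (∈⇒InSpan v<p (∈.∈-map⁺ (ξ j) u∈U)))
      where
      U = allU p n (j ∸ 1)
      u∈U = prefix-∈-padTo-allVecs M (D[j∸1]≤n j≤s) y<p
      v = ξ j (prefix M y)
      v∈ = proj₁ (valid j 1≤j j≤s _ u∈U)
      v<p = All.lookup (allVecs-reduced n) v∈
      U-unique : Unique U
      U-unique = Unique.map⁺ (padTo-injective n (D[j∸1]≤n j≤s)) (allVecs-unique M)
      ¾|U|≤|U| : 3 ℕ.* p ^ M ≤ 4 ℕ.* length U
      ¾|U|≤|U| = subst (λ k → 3 ℕ.* p ^ M ≤ 4 ℕ.* k) (sym (trans (List.length-map (padTo n) (allVecs p M)) (length-allVecs M)))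
        (ℕ.*-monoˡ-≤ (p ^ M) {3} {4} (ℕ.n≤1+n 3))
      basis-supported : All (λ b → prefix (D p j) b ≡ b) (basisRange n M (D p j))
      basis-supported = All.map⁺ (All.map
        (λ {t} t<D∸M → prefix-e n (ℕ.<-≤-trans (ℕ.+-monoʳ-< M t<D∸M) (ℕ.≤-reflexive (ℕ.m+[n∸m]≡n (D[j∸1]≤D[j] j)))))
        (All.all-upTo (D p j ∸ M)))
      supported : ∀ {v} → InSpan p (basisRange n M (D p j)) v → prefix (D p j) v ≡ v
      supported (cs , _ , refl) = prefix-lincomb (D p j) cs basis-supported

    𝟙A-prefix-cong : ∀ {m} → D p j ≤ m → ∀ {y y′} → Reduced y → Reduced y′ → prefix m y ≡ prefix m y′ → 𝟙A j y ≡ 𝟙A j y′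
    𝟙A-prefix-cong {m} D≤m {y} {y′} y<p y′<p y≡y′ = cong indicator (begin
      inA p n j (ξ j) y                                        ≡⟨ inA≡suffix-dot j j≤s y<p ⟩
      (dot p (suffix M y) (ξ j (prefix M y)) ≡ᵇ 0)              ≡⟨ cong (_≡ᵇ 0) (through-prefix y<p) ⟩
      (dot p (suffix M (prefix (D p j) y)) (ξ j (prefix M y)) ≡ᵇ 0)
        ≡⟨ cong₂ (λ z u → dot p (suffix M z) (ξ j u) ≡ᵇ 0) (prefix-≡-mono D≤m y≡y′)
                 (prefix-≡-mono (ℕ.≤-trans (D[j∸1]≤D[j] j) D≤m) y≡y′) ⟩
      (dot p (suffix M (prefix (D p j) y′)) (ξ j (prefix M y′)) ≡ᵇ 0) ≡⟨ cong (_≡ᵇ 0) (through-prefix y′<p) ⟨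
      (dot p (suffix M y′) (ξ j (prefix M y′)) ≡ᵇ 0)            ≡⟨ inA≡suffix-dot j j≤s y′<p ⟨
      inA p n j (ξ j) y′                                       ∎)
      where
      open ≡-Reasoning
      through-prefix : ∀ {y} → Reduced y →
        dot p (suffix M y) (ξ j (prefix M y)) ≡ dot p (suffix M (prefix (D p j) y)) (ξ j (prefix M y))
      through-prefix {y} y<p = begin
        dot p (suffix M y) (ξ j (prefix M y))                        ≡⟨ cong (dot p (suffix M y)) (ξ-supported y<p) ⟨
        dot p (suffix M y) (prefix (D p j) (ξ j (prefix M y)))       ≡⟨ cong (_% p) (dotℕ-prefix (D p j) (suffix M y) _) ⟩
        dot p (prefix (D p j) (suffix M y)) (ξ j (prefix M y))       ≡⟨ cong (λ z → dot p z (ξ j (prefix M y))) (prefix-suffix (D p j) M y) ⟩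
        dot p (suffix M (prefix (D p j) y)) (ξ j (prefix M y))       ∎

    ∑-coset-𝟙A : ∀ {x} → Reduced x → ∑ (coset M x) (𝟙A j) ≡ fromℕ (p ^ (n ∸ M)) * ρ
    ∑-coset-𝟙A {x} x<p with ζ<p , ζ≢0 , ζ∈H ← ξ-valid x<p = begin
      ∑ (coset M x) (𝟙A j)              ≡⟨ ∑-cong (All.map on-kernel (coset-prefix M x<p)) ⟩
      S                                 ≡⟨ ℚ.*-identityʳ S ⟨
      S * 1ℚ                            ≡⟨ cong (S *_) p·ρ≡1 ⟨
      S * (fromℕ p * ρ)                 ≡⟨ ℚ.*-assoc S (fromℕ p) ρ ⟨
      S * fromℕ p * ρ                   ≡⟨ cong (_* ρ) (∑-coset-kernel M x ζ<p ζ≢0 ζ∈H) ⟩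
      fromℕ (p ^ (n ∸ M)) * ρ           ∎
      where
      open ≡-Reasoning
      ζ = ξ j (prefix M x)
      S = ∑ (coset M x) (λ y → indicator (dot p (suffix M y) ζ ≡ᵇ 0))
      on-kernel : ∀ {y} → Reduced y × prefix M y ≡ prefix M x → 𝟙A j y ≡ indicator (dot p (suffix M y) ζ ≡ᵇ 0)
      on-kernel {y} (y<p , y≡x) =
        cong indicator (trans (inA≡suffix-dot j j≤s y<p) (cong (λ u → dot p (suffix M y) (ξ j u) ≡ᵇ 0) y≡x))

  average : ℕ → (Vec ℕ n → ℚ) → Vec ℕ n → ℚ
  average k h x = ∑ (coset (D p k) x) h * recipℕ (p ^ (n ∸ D p k))

  condExp𝟙A : ℕ → ℕ → Vec ℕ n → ℚ
  condExp𝟙A k j x = if j ≤ᵇ k then 𝟙A j x else ρ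

  average-𝟙A : ∀ {j k} → 1 ≤ j → j ≤ s → k ≤ s → ∀ {x} → Reduced x → average k (𝟙A j) x ≡ condExp𝟙A k j x
  average-𝟙A {j} {k} 1≤j j≤s k≤s {x} x<p with j ℕ.≤? k
  ... | yes j≤k rewrite ≤⇒≤ᵇ-true j≤k = begin
    ∑ (coset (D p k) x) (𝟙A j) * R                      ≡⟨ cong (_* R) (∑-coset-const (D p k) (𝟙A j) x<p
                                                            (λ y<p y≡x → 𝟙A-prefix-cong 1≤j j≤s (D-mono p j≤k) y<p x<p y≡x)) ⟩
    𝟙A j x * fromℕ (p ^ (n ∸ D p k)) * R                 ≡⟨ ℚ.*-assoc (𝟙A j x) _ R ⟩
    𝟙A j x * (fromℕ (p ^ (n ∸ D p k)) * R)               ≡⟨ cong (𝟙A j x *_) (fromℕ-*-recipℕ _ (ℕ.m^n>0 p (n ∸ D p k))) ⟩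
    𝟙A j x * 1ℚ                                         ≡⟨ ℚ.*-identityʳ (𝟙A j x) ⟩
    𝟙A j x                                              ∎
    where
    open ≡-Reasoning
    R = recipℕ (p ^ (n ∸ D p k))
  ... | no j≰k rewrite >⇒≤ᵇ-false (ℕ.≰⇒> j≰k) = begin
    ∑ (coset (D p k) x) (𝟙A j) * R                      ≡⟨ cong (_* R) (∑-coset-tower (D p k) M (𝟙A j) (N * ρ) D[k]≤M (D[j∸1]≤n j≤s)
                                                            (∑-coset-𝟙A 1≤j j≤s) x<p) ⟩
    N * ρ * fromℕ (p ^ (M ∸ D p k)) * R                  ≡⟨ solve 4 (λ N r Y R → N :* r :* Y :* R := r :* ((N :* Y) :* R)) refl N ρ _ R ⟩
    ρ * ((N * fromℕ (p ^ (M ∸ D p k))) * R)              ≡⟨ cong (λ t → ρ * (t * R)) N·p^[M∸Dk] ⟩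
    ρ * (fromℕ (p ^ (n ∸ D p k)) * R)                    ≡⟨ cong (ρ *_) (fromℕ-*-recipℕ _ (ℕ.m^n>0 p (n ∸ D p k))) ⟩
    ρ * 1ℚ                                              ≡⟨ ℚ.*-identityʳ ρ ⟩
    ρ                                                   ∎
    where
    open ≡-Reasoning
    open ℚ-Solver
    R = recipℕ (p ^ (n ∸ D p k))
    M = D p (j ∸ 1)
    N = fromℕ (p ^ (n ∸ M))
    D[k]≤M : D p k ≤ M
    D[k]≤M = D-mono p (ℕ.∸-monoˡ-≤ 1 (ℕ.≰⇒> j≰k))
    N·p^[M∸Dk] : N * fromℕ (p ^ (M ∸ D p k)) ≡ fromℕ (p ^ (n ∸ D p k))
    N·p^[M∸Dk] = trans (sym (fromℕ-* (p ^ (n ∸ M)) (p ^ (M ∸ D p k)))) (cong fromℕ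
      (trans (sym (ℕ.^-distribˡ-+-* p (n ∸ M) (M ∸ D p k))) (cong (p ^_)
        (trans (ℕ.+-comm (n ∸ M) (M ∸ D p k)) (trans (sym (ℕ.+-∸-comm (n ∸ M) D[k]≤M))
          (cong (_∸ D p k) (ℕ.m+[n∸m]≡n (D[j∸1]≤n j≤s))))))))

  condExp : ℕ → Vec ℕ n → ℚ
  condExp k x = sumFrom1 s (λ j → w j * condExp𝟙A k j x)

  average-f : ∀ {k} → k ≤ s → ∀ {x} → Reduced x → average k (f p n s ξ w) x ≡ condExp k x
  average-f {k} k≤s {x} x<p = begin
    ∑ C (f p n s ξ w) * R                                ≡⟨ cong (_* R) (∑-sumFrom1 C s (λ y j → w j * 𝟙A j y)) ⟩
    sumFrom1 s (λ j → ∑ C (λ y → w j * 𝟙A j y)) * R      ≡⟨ sumFrom1-*ʳ s _ R ⟩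
    sumFrom1 s (λ j → ∑ C (λ y → w j * 𝟙A j y) * R)      ≡⟨ sumFrom1-cong s weighted ⟩
    condExp k x                                          ∎
    where
    open ≡-Reasoning
    C = coset (D p k) x
    R = recipℕ (p ^ (n ∸ D p k))
    weighted : ∀ {j} → 1 ≤ j → j ≤ s → ∑ C (λ y → w j * 𝟙A j y) * R ≡ w j * condExp𝟙A k j x
    weighted {j} 1≤j j≤s = trans (cong (_* R) (∑-*ˡ C (w j) (𝟙A j)))
      (trans (ℚ.*-assoc (w j) _ R) (cong (w j *_) (average-𝟙A 1≤j j≤s k≤s x<p)))

  energy≡∑condExp² : ∀ {k} → k ≤ s →
    energy p n (inH p n k) (f p n s ξ w) ≡ ∑ (allVecs p n) (λ x → condExp k x * condExp k x) * recipℕ (p ^ n)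
  energy≡∑condExp² {k} k≤s = trans (mean-map (allVecs p n) _)
    (cong₂ _*_ (∑-cong (All.map (λ x<p → cong (λ t → t * t) (mean-coset x<p)) (allVecs-reduced n)))
               (cong recipℕ (length-allVecs n)))
    where
    mean-coset : ∀ {x} → Reduced x →
      mean (List.map (f p n s ξ w) (filterᵇ (λ y → inH p n k (vsub p y x)) (allVecs p n))) ≡ condExp k x
    mean-coset {x} x<p = begin
      mean (List.map (f p n s ξ w) (filterᵇ (λ y → inH p n k (vsub p y x)) (allVecs p n)))
        ≡⟨ cong (mean ∘ List.map (f p n s ξ w)) (trans
             (filterᵇ-cong _ _ (allVecs p n) (λ y → inH≡zeroPrefix n k (vsub p y x)))
             (filter-zeroPrefix-vsub n (D p k) x<p)) ⟩
      mean (List.map (f p n s ξ w) (coset (D p k) x))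
        ≡⟨ mean-map (coset (D p k) x) (f p n s ξ w) ⟩
      ∑ (coset (D p k) x) (f p n s ξ w) * recipℕ (length (coset (D p k) x))
        ≡⟨ cong (λ ℓ → ∑ (coset (D p k) x) (f p n s ξ w) * recipℕ ℓ) (length-coset (D p k) x) ⟩
      average k (f p n s ξ w) x
        ≡⟨ average-f k≤s x<p ⟩
      condExp k x ∎
      where open ≡-Reasoning

  module Increment {i} (1≤i : 1 ≤ i) (i≤s : i ≤ s) where

    private
      M  = D p (i ∸ 1)
      N  = fromℕ (p ^ n)
      ww = w i * w i

    others : Vec ℕ n → ℚ
    others x = sumFrom1 s (λ j → if j ≡ᵇ i then 0ℚ else w j * condExp𝟙A i j x)

    condExp-i : ∀ x → condExp i x ≡ others x + w i * 𝟙A i x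
    condExp-i x = trans (sumFrom1-extract s (λ j → w j * condExp𝟙A i j x) 1≤i i≤s)
      (cong (λ b → others x + w i * (if b then 𝟙A i x else ρ)) (≤⇒≤ᵇ-true (ℕ.≤-refl {i})))

    condExp-i∸1 : ∀ x → condExp (i ∸ 1) x ≡ others x + w i * ρ
    condExp-i∸1 x = trans (sumFrom1-extract s (λ j → w j * condExp𝟙A (i ∸ 1) j x) 1≤i i≤s)
      (cong₂ _+_ (sumFrom1-cong s (λ {j} _ _ → same-others j (j ℕ.≟ i)))
                 (cong (λ b → w i * (if b then 𝟙A i x else ρ)) (>⇒≤ᵇ-false (ℕ.∸-monoʳ-< {o = 0} (s≤s z≤n) 1≤i))))
      where
      same-others : ∀ j → Dec (j ≡ i) →
        (if j ≡ᵇ i then 0ℚ else w j * condExp𝟙A (i ∸ 1) j x) ≡ (if j ≡ᵇ i then 0ℚ else w j * condExp𝟙A i j x)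
      same-others j (yes refl) rewrite ≡ᵇ-refl j = refl
      same-others j (no j≢i) rewrite ≢⇒≡ᵇ-false j≢i | ≤ᵇ-pred 1≤i j≢i = refl

    others-prefix-cong : ∀ {x y} → Reduced x → Reduced y → prefix M y ≡ prefix M x → others y ≡ others x
    others-prefix-cong {x} {y} x<p y<p y≡x = sumFrom1-cong s term
      where
      term : ∀ {j} → 1 ≤ j → j ≤ s →
        (if j ≡ᵇ i then 0ℚ else w j * condExp𝟙A i j y) ≡ (if j ≡ᵇ i then 0ℚ else w j * condExp𝟙A i j x)
      term {j} 1≤j j≤s with j ℕ.≟ i
      ... | yes refl rewrite ≡ᵇ-refl j = refl
      ... | no j≢i rewrite ≢⇒≡ᵇ-false j≢i with j ℕ.≤? i
      ...   | no j≰i rewrite >⇒≤ᵇ-false (ℕ.≰⇒> j≰i) = refl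
      ...   | yes j≤i rewrite ≤⇒≤ᵇ-true j≤i =
        cong (w j *_) (𝟙A-prefix-cong 1≤j j≤s (D-mono p (ℕ.∸-monoˡ-≤ 1 (ℕ.≤∧≢⇒< j≤i j≢i))) y<p x<p y≡x)

    ∑-others·[𝟙A-ρ] : ∑ (allVecs p n) (λ x → others x * (𝟙A i x - ρ)) ≡ 0ℚ
    ∑-others·[𝟙A-ρ] = trans (∑-coset-tower 0 M _ 0ℚ z≤n (D[j∸1]≤n i≤s) on-coset (zeroV-reduced n)) (ℚ.*-zeroˡ (fromℕ (p ^ M)))
      where
      on-coset : ∀ {x} → Reduced x → ∑ (coset M x) (λ y → others y * (𝟙A i y - ρ)) ≡ 0ℚ
      on-coset {x} x<p = begin
        ∑ C (λ y → others y * (𝟙A i y - ρ))      ≡⟨ ∑-cong (All.map (λ (y<p , y≡x) → cong (_* _) (others-prefix-cong x<p y<p y≡x))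
                                                                (coset-prefix M x<p)) ⟩
        ∑ C (λ y → others x * (𝟙A i y - ρ))      ≡⟨ ∑-*ˡ C (others x) (λ y → 𝟙A i y - ρ) ⟩
        others x * ∑ C (λ y → 𝟙A i y - ρ)        ≡⟨ cong (others x *_) (∑-- C (𝟙A i) (λ _ → ρ)) ⟩
        others x * (∑ C (𝟙A i) - ∑ C (λ _ → ρ))  ≡⟨ cong₂ (λ a b → others x * (a - b)) (∑-coset-𝟙A 1≤i i≤s x<p)
                                                          (trans (∑-const C ρ) (cong (λ ℓ → ρ * fromℕ ℓ) (length-coset M x))) ⟩
        others x * (K * ρ - ρ * K)               ≡⟨ solve 3 (λ b K r → b :* (K :* r :- r :* K) := con 0ℚ) refl (others x) K ρ ⟩
        0ℚ                                       ∎
        where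
        open ≡-Reasoning
        open ℚ-Solver
        C = coset M x
        K = fromℕ (p ^ (n ∸ M))

    ∑-𝟙A : ∑ (allVecs p n) (𝟙A i) ≡ ρ * fromℕ (p ^ n)
    ∑-𝟙A = begin
      ∑ (allVecs p n) (𝟙A i)                             ≡⟨ ∑-coset-tower 0 M (𝟙A i) _ z≤n (D[j∸1]≤n i≤s) (∑-coset-𝟙A 1≤i i≤s) (zeroV-reduced n) ⟩
      fromℕ (p ^ (n ∸ M)) * ρ * fromℕ (p ^ M)             ≡⟨ solve 3 (λ K r L → K :* r :* L := r :* (K :* L)) refl (fromℕ (p ^ (n ∸ M))) ρ (fromℕ (p ^ M)) ⟩
      ρ * (fromℕ (p ^ (n ∸ M)) * fromℕ (p ^ M))           ≡⟨ cong (ρ *_) (sym (fromℕ-* (p ^ (n ∸ M)) (p ^ M))) ⟩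
      ρ * fromℕ (p ^ (n ∸ M) ℕ.* p ^ M)                   ≡⟨ cong (λ k → ρ * fromℕ k) (sym (ℕ.^-distribˡ-+-* p (n ∸ M) M)) ⟩
      ρ * fromℕ (p ^ (n ∸ M ℕ.+ M))                       ≡⟨ cong (λ k → ρ * fromℕ (p ^ k)) (ℕ.m∸n+n≡m (D[j∸1]≤n i≤s)) ⟩
      ρ * fromℕ (p ^ n)                                   ∎
      where
      open ≡-Reasoning
      open ℚ-Solver

    condExp²-difference : ∀ x → condExp i x * condExp i x - condExp (i ∸ 1) x * condExp (i ∸ 1) x
      ≡ (w i + w i) * (others x * (𝟙A i x - ρ)) + (w i * w i * 𝟙A i x - w i * w i * (ρ * ρ))
    condExp²-difference x = begin
      condExp i x * condExp i x - condExp (i ∸ 1) x * condExp (i ∸ 1) x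
        ≡⟨ cong₂ (λ a b → a * a - b * b) (condExp-i x) (condExp-i∸1 x) ⟩
      (b + w i * 𝟙A i x) * (b + w i * 𝟙A i x) - (b + w i * ρ) * (b + w i * ρ)
        ≡⟨ solve 4 (λ B w t r → (B :+ w :* t) :* (B :+ w :* t) :- (B :+ w :* r) :* (B :+ w :* r)
                    := (w :+ w) :* (B :* (t :- r)) :+ (w :* w :* (t :* t) :- w :* w :* (r :* r))) refl (others x) (w i) (𝟙A i x) ρ ⟩
      (w i + w i) * (b * (𝟙A i x - ρ)) + (w i * w i * (𝟙A i x * 𝟙A i x) - w i * w i * (ρ * ρ))
        ≡⟨ cong (λ t → (w i + w i) * (b * (𝟙A i x - ρ)) + (w i * w i * t - w i * w i * (ρ * ρ)))
                (indicator-idem (inA p n i (ξ i) x)) ⟩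
      (w i + w i) * (b * (𝟙A i x - ρ)) + (w i * w i * 𝟙A i x - w i * w i * (ρ * ρ)) ∎
      where
      open ≡-Reasoning
      open ℚ-Solver
      b = others x

    ∑-condExp²-difference : ∑ (allVecs p n) (λ x → condExp i x * condExp i x - condExp (i ∸ 1) x * condExp (i ∸ 1) x)
                          ≡ ww * (ρ * N) - ww * (ρ * ρ) * N
    ∑-condExp²-difference = begin
      ∑ X (λ x → condExp i x * condExp i x - condExp (i ∸ 1) x * condExp (i ∸ 1) x)
        ≡⟨ ∑-ext X condExp²-difference ⟩
      ∑ X (λ x → (w i + w i) * (others x * (𝟙A i x - ρ)) + (ww * 𝟙A i x - ww * (ρ * ρ)))
        ≡⟨ ∑-+ X _ _ ⟩
      ∑ X (λ x → (w i + w i) * (others x * (𝟙A i x - ρ))) + ∑ X (λ x → ww * 𝟙A i x - ww * (ρ * ρ))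
        ≡⟨ cong₂ _+_ (∑-*ˡ X (w i + w i) _) (∑-- X _ _) ⟩
      (w i + w i) * ∑ X (λ x → others x * (𝟙A i x - ρ)) + (∑ X (λ x → ww * 𝟙A i x) - ∑ X (λ _ → ww * (ρ * ρ)))
        ≡⟨ cong₂ (λ a b → (w i + w i) * a + b) ∑-others·[𝟙A-ρ] (cong₂ _-_
             (trans (∑-*ˡ X ww (𝟙A i)) (cong (ww *_) ∑-𝟙A))
             (trans (∑-const X (ww * (ρ * ρ))) (cong (λ ℓ → ww * (ρ * ρ) * fromℕ ℓ) (length-allVecs n)))) ⟩
      (w i + w i) * 0ℚ + (ww * (ρ * N) - ww * (ρ * ρ) * N)
        ≡⟨ trans (cong (_+ (ww * (ρ * N) - ww * (ρ * ρ) * N)) (ℚ.*-zeroʳ (w i + w i))) (ℚ.+-identityˡ _) ⟩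
      ww * (ρ * N) - ww * (ρ * ρ) * N ∎
      where
      open ≡-Reasoning
      X = allVecs p n

    energy-increment : energy p n (inH p n i) (f p n s ξ w) - energy p n (inH p n (i ∸ 1)) (f p n s ξ w)
                     ≡ w i * w i * (ρ * ρ) * fromℕ p-1
    energy-increment = begin
      energy p n (inH p n i) (f p n s ξ w) - energy p n (inH p n (i ∸ 1)) (f p n s ξ w)
        ≡⟨ cong₂ _-_ (energy≡∑condExp² i≤s) (energy≡∑condExp² (ℕ.≤-trans (ℕ.m∸n≤m i 1) i≤s)) ⟩
      ∑ X (λ x → G x * G x) * R - ∑ X (λ x → G′ x * G′ x) * R
        ≡⟨ solve 3 (λ a b R → a :* R :- b :* R := (a :- b) :* R) refl (∑ X (λ x → G x * G x)) (∑ X (λ x → G′ x * G′ x)) R ⟩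
      (∑ X (λ x → G x * G x) - ∑ X (λ x → G′ x * G′ x)) * R
        ≡⟨ cong (_* R) (trans (sym (∑-- X (λ x → G x * G x) (λ x → G′ x * G′ x))) ∑-condExp²-difference) ⟩
      (ww * (ρ * N) - ww * (ρ * ρ) * N) * R
        ≡⟨ solve 4 (λ w r N R → (w :* (r :* N) :- w :* (r :* r) :* N) :* R := (w :* r :- w :* (r :* r)) :* (N :* R)) refl ww ρ N R ⟩
      (ww * ρ - ww * (ρ * ρ)) * (N * R)
        ≡⟨ cong ((ww * ρ - ww * (ρ * ρ)) *_) (fromℕ-*-recipℕ (p ^ n) (ℕ.m^n>0 p n)) ⟩
      (ww * ρ - ww * (ρ * ρ)) * 1ℚ
        ≡⟨ ℚ.*-identityʳ _ ⟩
      ww * ρ - ww * (ρ * ρ)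
        ≡⟨ cong (λ t → ww * t - ww * (ρ * ρ)) (sym (trans (cong (ρ *_) p·ρ≡1) (ℚ.*-identityʳ ρ))) ⟩
      ww * (ρ * (fromℕ p * ρ)) - ww * (ρ * ρ)
        ≡⟨ solve 3 (λ w r P → w :* (r :* ((con 1ℚ :+ P) :* r)) :- w :* (r :* r) := w :* (r :* r) :* P) refl ww ρ (fromℕ p-1) ⟩
      ww * (ρ * ρ) * fromℕ p-1 ∎
      where
      open ≡-Reasoning
      open ℚ-Solver
      X = allVecs p n
      R = recipℕ (p ^ n)
      G G′ : Vec ℕ n → ℚ
      G  = condExp i
      G′ = condExp (i ∸ 1)

proposition3p2 : (p : ℕ) → Prime p → (s n : ℕ) → D p s ≤ n →
    (ξ : ℕ → Vec ℕ n → Vec ℕ n) → ValidX p n s ξ → SpanningX p n s ξ →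
    (w : ℕ → ℚ) → (∀ i → 1 ≤ i → i ≤ s → (0ℚ ℚ.< w i) × (w i ℚ.< 1ℚ)) →
    sumFrom1 s w ≤ℚ 1ℚ →
    ∀ i → 1 ≤ i → i ≤ s →
    (w i * w i) * recipℕ (p ^ 2)
    ≤ℚ (energy p n (inH p n i) (f p n s ξ w) - energy p n (inH p n (i ∸ 1)) (f p n s ξ w))
proposition3p2 0 p-prime = ⊥-elim (ℕ.NonZero.nonZero (prime⇒nonZero p-prime))
proposition3p2 1 p-prime = ⊥-elim (ℕ.NonTrivial.nonTrivial (prime⇒nonTrivial p-prime))
proposition3p2 p@(suc (suc q)) p-prime s n Ds≤n ξ valid spanning w w-bounds _ i 1≤i i≤s =
  subst₂ _≤ℚ_ (cong (w i * w i *_) (sym recipℕ-p²)) (sym energy-increment)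
    (≤-*-fromℕ-suc q (*-nonNeg (*-nonNeg 0≤wᵢ 0≤wᵢ) (*-nonNeg (recipℕ-nonNeg p) (recipℕ-nonNeg p))))
  where
  open Construction (suc q) p-prime n s Ds≤n ξ valid spanning w
  open Increment 1≤i i≤s
  0≤wᵢ : 0ℚ ≤ℚ w i
  0≤wᵢ = ℚ.<⇒≤ (proj₁ (w-bounds i 1≤i i≤s))
  recipℕ-p² : recipℕ (p ^ 2) ≡ ρ * ρ
  recipℕ-p² = trans (cong recipℕ (cong (p ℕ.*_) (ℕ.*-identityʳ p))) (recipℕ-* p p (s≤s z≤n) (s≤s z≤n))
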